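{- If $r\ge3$ and $2\le u,v\le r$, then the vincular patterns $1\cdots(u-1)(u+1)\cdots(r+1)\text{ - }u$ and $1\cdots(v-1)(v+1)\cdots(r+1)\text{ - }v$ are Wilf-equivalent.
   Context: For $k\ge1$ let $[k]=\{1,\dots,k\}$; a $k$-ary word of length $n$ is an element of $[k]^n$. Two words are order-isomorphic if replacing the $i$-th smallest distinct letter by $i$ yields the same word. The vincular pattern $\alpha_1\cdots\alpha_r\text{ - }\alpha_{r+1}$ (here $\alpha_1\cdots\alpha_r$ is the strictly increasing sequence $1,\dots,u-1,u+1,\dots,r+1$ and $\alpha_{r+1}=u$) occurs in a word $w=w_1\cdots w_n$ if there are indices $p$ and $q>p+r-1$ such that $w_pw_{p+1}\cdots w_{p+r-1}w_q$ is order-isomorphic to $\alpha_1\cdots\alpha_{r+1}$; otherwise $w$ avoids it. For a pattern $\sigma$, $a_\sigma(n,k)$ is the number of words in $[k]^n$ avoiding $\sigma$; $\sigma\sim\tau$ (Wilf-equivalence) means $a_\sigma(n,k)=a_\tau(n,k)$ for all $n\ge0,k\ge1$. -}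

module Defs where

open import Data.Nat using (ℕ; zero; suc; _+_; _≤_; _≡ᵇ_; _≤ᵇ_)
open import Data.Nat.Properties using (_≟_)
open import Data.Bool using (Bool; true; false; not; _∧_)
open import Data.Bool.ListAction using (any)
open import Data.List using (List; []; _∷_; [_]; _++_; map; filterᵇ; length; upTo; take; drop; concatMap; applyUpTo; allFin)
open import Data.List.Properties using (≡-dec)
open import Data.Fin using (Fin; toℕ)
open import Data.Vec using (Vec; toList)
import Data.Vec as V
open import Relation.Nullary.Decidable using (isYes)
open import Relation.Binary.PropositionalEquality using (_≡_)

-- All k-ary words of length n; the letter i ∈ [k] is encoded as i-1 ∈ Fin k
-- (a uniform shift, which does not affect order-isomorphism).
words : (n k : ℕ) → List (Vec (Fin k) n)
words zero    k = [ V.[] ]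
words (suc n) k = concatMap (λ a → map (a V.∷_) (words n k)) (allFin k)

-- Reduction of a word: replace the i-th smallest distinct letter by i,
-- i.e. x ↦ 1 + #(distinct letters y occurring in the word with y < x).
reduce : List ℕ → List ℕ
reduce ws = map (λ x → suc (length (filterᵇ (λ y → any (λ z → y ≡ᵇ z) ws) (upTo x)))) ws

orderIso? : List ℕ → List ℕ → Bool
orderIso? a b = isYes (≡-dec _≟_ (reduce a) (reduce b))

vpattern : (r u : ℕ) → List ℕ
vpattern r u = filterᵇ (λ i → not (i ≡ᵇ u)) (applyUpTo suc (suc r)) ++ [ u ]

-- w contains the vincular pattern α₁⋯α_r-α_{r+1}: there are (0-based) positions
-- p, q < length w with q > p + r - 1 such that w_p ⋯ w_{p+r-1} w_q is
-- order-isomorphic to α₁⋯α_{r+1}.  (q < length w and q ≥ p + r force the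
-- factor w_p ⋯ w_{p+r-1} to lie inside w.)
occurs : (r u : ℕ) → List ℕ → Bool
occurs r u w =
  any (λ p → any (λ q → (p + r ≤ᵇ q) ∧ orderIso? (take r (drop p w) ++ take 1 (drop q w)) (vpattern r u))
                 (upTo (length w)))
      (upTo (length w))

avoidCount : (r u n k : ℕ) → ℕ
avoidCount r u n k = length (filterᵇ (λ w → not (occurs r u (toList (V.map toℕ w)))) (words n k))

WilfEquiv : (r u v : ℕ) → Set
WilfEquiv r u v = ∀ (n k : ℕ) → 1 ≤ k → avoidCount r u n k ≡ avoidCount r v n k

-- With u = a + 2, a letter z completes an occurrence exactly when some earlier factor of r
-- increasing letters t₀ < ⋯ < t_{r-1} has t_a < z < t_{a+1}.  Scanning from the left, the avoiders
-- are thus the words accepted by an automaton whose state is the set of forbidden letters and the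
-- final ascending run.  For counting, this state compresses to the number U of usable letters above
-- the last letter of the run, the number c below it, and the list D of rank gaps along the run: a
-- completed window forbids (its gap at position a) − 1 letters, the only place where a enters.
-- Grouping continuations by their ascents before the next restart turns the count into sums over
-- tuples of positive gaps, symmetric under permutations of the gaps; moving the gap consumed at
-- position a + 1 to position a is such a permutation, so the count does not depend on a.
module Submission where

open import Data.Bool using (Bool; true; false; if_then_else_; T; _∧_; _∨_; not)
open import Data.Bool.Properties using (∨-identityʳ; ∨-zeroʳ; ∨-assoc; ∧-zeroʳ; ∧-identityʳ)
open import Data.Bool.ListAction using (any)
open import Data.Empty using (⊥-elim)
open import Data.Fin using (Fin; toℕ)
open import Data.List using (List; []; _∷_; _++_; _∷ʳ_; take; drop; length; map; filterᵇ; concatMap; allFin; tabulate; upTo; applyUpTo)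
open import Data.List.Properties using (++-identityʳ; ++-assoc; length-drop; length-++; filter-++; filter-none; filter-all; map-tabulate; tabulate-cong; upTo-∷ʳ; length-map; ≡-dec; length-applyUpTo; take-all; drop-[]; take-[]; drop-drop)
import Data.List.Relation.Unary.All as All
open import Data.List.Relation.Unary.All.Properties using (applyUpTo⁺₁)
open import Data.Nat
open import Data.Nat.Induction using (<-rec)
open import Data.Nat.ListAction using (sum)
open import Data.Nat.Properties
open import Data.Nat.Solver using (module +-*-Solver)
open import Data.Product using (_×_; _,_; proj₁)
open import Data.Sum using (inj₁; inj₂; _⊎_; [_,_]′)
open import Data.Vec using (Vec; toList)
import Data.Vec as V
open import Function.Base using (_∘_)
open import Relation.Binary using (tri<; tri≈; tri>)
open import Relation.Binary.PropositionalEquality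
open import Relation.Nullary using (yes; no; ¬_; contradiction)
open import Relation.Nullary.Decidable using (T?)

open import Defs

T⇒≡true : ∀ {b} → T b → b ≡ true
T⇒≡true {true} _ = refl

¬T⇒≡false : ∀ {b} → ¬ T b → b ≡ false
¬T⇒≡false {false} _ = refl
¬T⇒≡false {true} ¬t = ⊥-elim (¬t _)

<ᵇ-true : ∀ {m n} → m < n → (m <ᵇ n) ≡ true
<ᵇ-true m<n = T⇒≡true (<⇒<ᵇ m<n)

<ᵇ-false : ∀ {m n} → n ≤ m → (m <ᵇ n) ≡ false
<ᵇ-false {m} {n} n≤m = ¬T⇒≡false (λ t → <⇒≱ (<ᵇ⇒< m n t) n≤m)

<ᵇ-true⁻¹ : ∀ {m n} → (m <ᵇ n) ≡ true → m < n
<ᵇ-true⁻¹ {m} {n} e = <ᵇ⇒< m n (subst T (sym e) _)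

<ᵇ-false⁻¹ : ∀ {m n} → (m <ᵇ n) ≡ false → n ≤ m
<ᵇ-false⁻¹ {m} {n} e = ≮⇒≥ (λ m<n → subst T e (<⇒<ᵇ m<n))

≤ᵇ-true : ∀ {m n} → m ≤ n → (m ≤ᵇ n) ≡ true
≤ᵇ-true m≤n = T⇒≡true (≤⇒≤ᵇ m≤n)

≤ᵇ-false : ∀ {m n} → n < m → (m ≤ᵇ n) ≡ false
≤ᵇ-false {m} {n} n<m = ¬T⇒≡false (λ t → <⇒≱ n<m (≤ᵇ⇒≤ m n t))

≤ᵇ-true⁻¹ : ∀ {m n} → (m ≤ᵇ n) ≡ true → m ≤ n
≤ᵇ-true⁻¹ {m} {n} e = ≤ᵇ⇒≤ m n (subst T (sym e) _)

≡ᵇ-true : ∀ {m n} → m ≡ n → (m ≡ᵇ n) ≡ true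
≡ᵇ-true {m} {n} m≡n = T⇒≡true (≡⇒≡ᵇ m n m≡n)

≡ᵇ-false : ∀ {m n} → m ≢ n → (m ≡ᵇ n) ≡ false
≡ᵇ-false {m} {n} m≢n = ¬T⇒≡false (λ t → m≢n (≡ᵇ⇒≡ m n t))

n∸1<n : ∀ {n} → 1 ≤ n → n ∸ 1 < n
n∸1<n {suc n} _ = ≤-refl

∸-suc-< : ∀ {N n} → N < n → n ∸ suc N < n
∸-suc-< {N} {suc n} _ = s≤s (m∸n≤m n N)

+-∸-≤ : ∀ b m r L → b + m ≤ r → r ≤ L + m → b + (L + m ∸ r) ≤ L
+-∸-≤ b m r L b+m≤r r≤L+m = +-cancelʳ-≤ m _ _ (begin
    b + (L + m ∸ r) + m  ≡⟨ solve 3 (λ b m s → (b :+ s) :+ m := (b :+ m) :+ s) refl b m (L + m ∸ r) ⟩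
    b + m + (L + m ∸ r)  ≤⟨ +-monoˡ-≤ (L + m ∸ r) b+m≤r ⟩
    r + (L + m ∸ r)      ≡⟨ m+[n∸m]≡n r≤L+m ⟩
    L + m                ∎)
  where
    open ≤-Reasoning
    open +-*-Solver

∸-+-∸ : ∀ n L o → o ≤ L → L ≤ n → (n ∸ L) + o ≡ n ∸ (L ∸ o)
∸-+-∸ n L o o≤L L≤n = sym (trans (cong (_∸ (L ∸ o)) (sym total)) (m+n∸n≡m _ (L ∸ o)))
  where
    total : (n ∸ L) + o + (L ∸ o) ≡ n
    total = trans (+-assoc (n ∸ L) o _) (trans (cong ((n ∸ L) +_) (m+[n∸m]≡n o≤L)) (m∸n+n≡m L≤n))

∸+∸ : ∀ n m o → o ≤ m → m ≤ n → (n ∸ m) + (m ∸ o) ≡ n ∸ o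
∸+∸ n m o o≤m m≤n = trans (∸-+-∸ n m (m ∸ o) (m∸n≤m m o) m≤n) (cong (n ∸_) (m∸[m∸n]≡n o≤m))

<∸⇒+< : ∀ {i o L} → i < L ∸ o → o + i < L
<∸⇒+< {i} {o} {L} i<L∸o with o ≤? L
... | yes o≤L = subst (_≤ L) (cong suc (+-comm i o)) (m≤o∸n⇒m+n≤o (suc i) o≤L i<L∸o)
... | no  o≰L = ⊥-elim (n≮0 (subst (i <_) (m≤n⇒m∸n≡0 (<⇒≤ (≰⇒> o≰L))) i<L∸o))

∸-swap : ∀ U m n → U ∸ m ∸ n ≡ U ∸ n ∸ m
∸-swap U m n = trans (∸-+-assoc U m n) (trans (cong (U ∸_) (+-comm m n)) (sym (∸-+-assoc U n m)))

sumBelow : (ℕ → ℕ) → ℕ → ℕ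
sumBelow f zero = 0
sumBelow f (suc n) = sumBelow f n + f n

sumBelow-cong : ∀ {f g : ℕ → ℕ} n → (∀ i → i < n → f i ≡ g i) → sumBelow f n ≡ sumBelow g n
sumBelow-cong zero h = refl
sumBelow-cong (suc n) h = cong₂ _+_ (sumBelow-cong n (λ i i<n → h i (m<n⇒m<1+n i<n))) (h n ≤-refl)

sumBelow-cong′ : ∀ {f g : ℕ → ℕ} n → (∀ i → f i ≡ g i) → sumBelow f n ≡ sumBelow g n
sumBelow-cong′ n h = sumBelow-cong n (λ i _ → h i)

sumBelow-sucˡ : ∀ f n → sumBelow f (suc n) ≡ f 0 + sumBelow (λ i → f (suc i)) n
sumBelow-sucˡ f zero = +-comm 0 (f 0)
sumBelow-sucˡ f (suc n) = trans (cong (_+ f (suc n)) (sumBelow-sucˡ f n)) (+-assoc (f 0) _ _)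

sumBelow-+ : ∀ f m n → sumBelow f (m + n) ≡ sumBelow f m + sumBelow (λ i → f (m + i)) n
sumBelow-+ f m zero rewrite +-identityʳ m = sym (+-identityʳ _)
sumBelow-+ f m (suc n) rewrite +-suc m n =
  trans (cong (_+ f (m + n)) (sumBelow-+ f m n)) (+-assoc (sumBelow f m) _ _)

sumBelow-distrib-+ : ∀ f g n → sumBelow (λ i → f i + g i) n ≡ sumBelow f n + sumBelow g n
sumBelow-distrib-+ f g zero = refl
sumBelow-distrib-+ f g (suc n) rewrite sumBelow-distrib-+ f g n =
  solve 4 (λ a b c d → (a :+ b) :+ (c :+ d) := (a :+ c) :+ (b :+ d)) refl
    (sumBelow f n) (sumBelow g n) (f n) (g n)
  where open +-*-Solver

sumBelow-zero : ∀ n → sumBelow (λ _ → 0) n ≡ 0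
sumBelow-zero zero = refl
sumBelow-zero (suc n) rewrite sumBelow-zero n = refl

sumBelow-comm : ∀ (f : ℕ → ℕ → ℕ) m n →
  sumBelow (λ i → sumBelow (f i) n) m ≡ sumBelow (λ j → sumBelow (λ i → f i j) m) n
sumBelow-comm f zero n = sym (sumBelow-zero n)
sumBelow-comm f (suc m) n =
  trans (cong (_+ sumBelow (f m) n) (sumBelow-comm f m n))
        (sym (sumBelow-distrib-+ (λ j → sumBelow (λ i → f i j) m) (f m) n))

sumBelow-restrict : ∀ f m n → m ≤ n → sumBelow f m ≡ sumBelow (λ j → if j <ᵇ m then f j else 0) n
sumBelow-restrict f m n m≤n = begin
    sumBelow f m
  ≡⟨ sumBelow-cong m (λ i i<m → cong (if_then f i else 0) (sym (<ᵇ-true i<m))) ⟩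
    sumBelow g m
  ≡⟨ sym (+-identityʳ _) ⟩
    sumBelow g m + 0
  ≡⟨ cong (sumBelow g m +_) (sym (trans (sumBelow-cong′ (n ∸ m) (λ i → cong (if_then f (m + i) else 0) (<ᵇ-false (m≤m+n m i))))
                                        (sumBelow-zero (n ∸ m)))) ⟩
    sumBelow g m + sumBelow (λ i → g (m + i)) (n ∸ m)
  ≡⟨ sym (sumBelow-+ g m (n ∸ m)) ⟩
    sumBelow g (m + (n ∸ m))
  ≡⟨ cong (sumBelow g) (m+[n∸m]≡n m≤n) ⟩
    sumBelow g n ∎
  where
    open ≡-Reasoning
    g : ℕ → ℕ
    g j = if j <ᵇ m then f j else 0

<∸suc-sym : ∀ U i j → j < U ∸ suc i → i < U ∸ suc j
<∸suc-sym U i j p = m+n≤o⇒m≤o∸n (suc i) (subst (_≤ U) (+-comm (suc j) (suc i)) (m≤o∸n⇒m+n≤o (suc j) i<U p))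
  where
    i<U : suc i ≤ U
    i<U = <⇒≤ (m∸n≢0⇒n<m (λ e → n≮0 (subst (j <_) e p)))

<ᵇ∸suc-sym : ∀ U i j → (j <ᵇ U ∸ suc i) ≡ (i <ᵇ U ∸ suc j)
<ᵇ∸suc-sym U i j with j <? U ∸ suc i | i <? U ∸ suc j
... | yes p | _     = trans (<ᵇ-true p) (sym (<ᵇ-true (<∸suc-sym U i j p)))
... | no ¬p | yes q = ⊥-elim (¬p (<∸suc-sym U j i q))
... | no ¬p | no ¬q = trans (<ᵇ-false (≮⇒≥ ¬p)) (sym (<ᵇ-false (≮⇒≥ ¬q)))

sumBelow-triangle-comm : ∀ U (G : ℕ → ℕ → ℕ) →
  sumBelow (λ i → sumBelow (G i) (U ∸ suc i)) U ≡ sumBelow (λ i → sumBelow (λ j → G j i) (U ∸ suc i)) U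
sumBelow-triangle-comm U G = begin
    sumBelow (λ i → sumBelow (G i) (U ∸ suc i)) U
  ≡⟨ sumBelow-cong′ U (λ i → sumBelow-restrict (G i) (U ∸ suc i) U (m∸n≤m U (suc i))) ⟩
    sumBelow (λ i → sumBelow (λ j → if j <ᵇ U ∸ suc i then G i j else 0) U) U
  ≡⟨ sumBelow-comm _ U U ⟩
    sumBelow (λ j → sumBelow (λ i → if j <ᵇ U ∸ suc i then G i j else 0) U) U
  ≡⟨ sumBelow-cong′ U (λ j → sumBelow-cong′ U (λ i → cong (if_then G i j else 0) (<ᵇ∸suc-sym U i j))) ⟩
    sumBelow (λ j → sumBelow (λ i → if i <ᵇ U ∸ suc j then G i j else 0) U) U
  ≡⟨ sumBelow-cong′ U (λ j → sumBelow-restrict (λ i → G i j) (U ∸ suc j) U (m∸n≤m U (suc j))) ⟨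
    sumBelow (λ j → sumBelow (λ i → G i j) (U ∸ suc j)) U ∎
  where open ≡-Reasoning

-- Lookup with default 0 past the end.
nth : List ℕ → ℕ → ℕ
nth []       _       = 0
nth (x ∷ xs) zero    = x
nth (x ∷ xs) (suc i) = nth xs i

takeLast : ℕ → List ℕ → List ℕ
takeLast n xs = drop (length xs ∸ n) xs

lastOf : List ℕ → ℕ
lastOf xs = nth xs (length xs ∸ 1)

nth-++ˡ : ∀ xs ys i → i < length xs → nth (xs ++ ys) i ≡ nth xs i
nth-++ˡ (x ∷ xs) ys zero    _       = refl
nth-++ˡ (x ∷ xs) ys (suc i) (s≤s p) = nth-++ˡ xs ys i p

nth-++ʳ : ∀ xs ys i → nth (xs ++ ys) (length xs + i) ≡ nth ys i
nth-++ʳ []       ys i = refl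
nth-++ʳ (x ∷ xs) ys i = nth-++ʳ xs ys i

nth-∷ʳ-last : ∀ xs y → nth (xs ∷ʳ y) (length xs) ≡ y
nth-∷ʳ-last xs y = trans (cong (nth (xs ∷ʳ y)) (sym (+-identityʳ (length xs)))) (nth-++ʳ xs (y ∷ []) 0)

nth-drop : ∀ o xs i → nth (drop o xs) i ≡ nth xs (o + i)
nth-drop zero    xs       i = refl
nth-drop (suc o) []       i = refl
nth-drop (suc o) (x ∷ xs) i = nth-drop o xs i

drop-++ˡ : ∀ o (xs ys : List ℕ) → o ≤ length xs → drop o (xs ++ ys) ≡ drop o xs ++ ys
drop-++ˡ zero    xs       ys _       = refl
drop-++ˡ (suc o) (x ∷ xs) ys (s≤s p) = drop-++ˡ o xs ys p

take-++ˡ : ∀ m (xs ys : List ℕ) → m ≤ length xs → take m (xs ++ ys) ≡ take m xs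
take-++ˡ zero    xs       ys _       = refl
take-++ˡ (suc m) (x ∷ xs) ys (s≤s p) = cong (x ∷_) (take-++ˡ m xs ys p)

take-drop-++ˡ : ∀ p m (xs ys : List ℕ) → p + m ≤ length xs → take m (drop p (xs ++ ys)) ≡ take m (drop p xs)
take-drop-++ˡ p m xs ys p+m≤xs =
  trans (cong (take m) (drop-++ˡ p xs ys (≤-trans (m≤m+n p m) p+m≤xs)))
        (take-++ˡ m (drop p xs) ys (subst (m ≤_) (sym (length-drop p xs)) (m+n≤o⇒m≤o∸n m (subst (_≤ length xs) (+-comm p m) p+m≤xs))))

drop-length-++ : ∀ (xs ys : List ℕ) → drop (length xs) (xs ++ ys) ≡ ys
drop-length-++ []       ys = refl
drop-length-++ (x ∷ xs) ys = drop-length-++ xs ys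

length-∷ʳ : ∀ (xs : List ℕ) y → length (xs ∷ʳ y) ≡ suc (length xs)
length-∷ʳ xs y = trans (length-++ xs) (+-comm (length xs) 1)

lastOf-∷ʳ : ∀ ys x → lastOf (ys ∷ʳ x) ≡ x
lastOf-∷ʳ ys x rewrite length-∷ʳ ys x = nth-∷ʳ-last ys x

lastOf-drop : ∀ o ys → o < length ys → lastOf (drop o ys) ≡ lastOf ys
lastOf-drop o ys o<L rewrite length-drop o ys =
  trans (nth-drop o ys (length ys ∸ o ∸ 1)) (cong (nth ys) (begin
    o + (length ys ∸ o ∸ 1)   ≡⟨ +-∸-assoc o (m+n≤o⇒m≤o∸n 1 o<L) ⟨
    o + (length ys ∸ o) ∸ 1   ≡⟨ cong (_∸ 1) (m+[n∸m]≡n (<⇒≤ o<L)) ⟩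
    length ys ∸ 1             ∎))
  where open ≡-Reasoning

nth-∷ʳ-∀ : ∀ (P : ℕ → Set) ys x → (∀ i → i < length ys → P (nth ys i)) → P x →
           ∀ i → i < length (ys ∷ʳ x) → P (nth (ys ∷ʳ x) i)
nth-∷ʳ-∀ P ys x Pys Px i i<1+L with m≤n⇒m<n∨m≡n (s≤s⁻¹ (subst (i <_) (length-∷ʳ ys x) i<1+L))
... | inj₁ i<L  = subst P (sym (nth-++ˡ ys (x ∷ []) i i<L)) (Pys i i<L)
... | inj₂ refl = subst P (sym (nth-∷ʳ-last ys x)) Px

nth-drop-∀ : ∀ (P : ℕ → Set) o ys → (∀ i → i < length ys → P (nth ys i)) →
             ∀ i → i < length (drop o ys) → P (nth (drop o ys) i)
nth-drop-∀ P o ys Pys i i<L∸o =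
  subst P (sym (nth-drop o ys i)) (Pys (o + i) (<∸⇒+< (subst (i <_) (length-drop o ys) i<L∸o)))

Increasing : List ℕ → Set
Increasing T = ∀ i j → i < j → j < length T → nth T i < nth T j

Increasing-≤ : ∀ {T} → Increasing T → ∀ i j → i ≤ j → j < length T → nth T i ≤ nth T j
Increasing-≤ inc i j i≤j j<L with m≤n⇒m<n∨m≡n i≤j
... | inj₁ i<j  = <⇒≤ (inc i j i<j j<L)
... | inj₂ refl = ≤-refl

Increasing-drop : ∀ o ys → Increasing ys → Increasing (drop o ys)
Increasing-drop o ys inc i j i<j j<L∸o rewrite nth-drop o ys i | nth-drop o ys j =
  inc (o + i) (o + j) (+-monoʳ-< o i<j) (<∸⇒+< (subst (j <_) (length-drop o ys) j<L∸o))

Increasing-∷ʳ : ∀ ys x → Increasing ys → (1 ≤ length ys → lastOf ys < x) → Increasing (ys ∷ʳ x)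
Increasing-∷ʳ ys x inc last<x i j i<j j<1+L with m≤n⇒m<n∨m≡n (s≤s⁻¹ (subst (j <_) (length-∷ʳ ys x) j<1+L))
... | inj₁ j<L  rewrite nth-++ˡ ys (x ∷ []) i (<-trans i<j j<L) | nth-++ˡ ys (x ∷ []) j j<L = inc i j i<j j<L
... | inj₂ refl rewrite nth-++ˡ ys (x ∷ []) i i<j | nth-∷ʳ-last ys x =
  ≤-<-trans (Increasing-≤ {ys} inc i (length ys ∸ 1) (m+n≤o⇒m≤o∸n i (subst (_≤ length ys) (+-comm 1 i) i<j)) (n∸1<n 1≤ys))
            (last<x 1≤ys)
  where
    1≤ys : 1 ≤ length ys
    1≤ys = ≤-trans (s≤s z≤n) i<j

SuffixOf : List ℕ → List ℕ → Set
SuffixOf T h = T ≡ drop (length h ∸ length T) h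

suffix-length : ∀ {T h} → SuffixOf T h → length T ≤ length h
suffix-length {T} {h} suf = subst (_≤ length h) (sym (trans (cong length suf) (length-drop (length h ∸ length T) h)))
                                  (m∸n≤m (length h) (length h ∸ length T))

suffix-drop : ∀ o {T h} → o ≤ length T → SuffixOf T h → SuffixOf (drop o T) h
suffix-drop o {T} {h} o≤T suf = trans (cong (drop o) suf) (trans (drop-drop (length h ∸ length T) o h) (cong (λ n → drop n h) offset))
  where
    offset : length h ∸ length T + o ≡ length h ∸ length (drop o T)
    offset = trans (∸-+-∸ (length h) (length T) o o≤T (suffix-length suf)) (cong (length h ∸_) (sym (length-drop o T)))

suffix-∷ʳ : ∀ x {T h} → SuffixOf T h → SuffixOf (T ∷ʳ x) (h ∷ʳ x)
suffix-∷ʳ x {T} {h} suf rewrite length-∷ʳ T x | length-∷ʳ h x =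
  trans (cong (_∷ʳ x) suf) (sym (drop-++ˡ (length h ∸ length T) h (x ∷ []) (m∸n≤m (length h) (length T))))

nth-suffix : ∀ {T h} → SuffixOf T h → ∀ i → nth T i ≡ nth h (length h ∸ length T + i)
nth-suffix {T} {h} suf i = trans (cong (λ l → nth l i) suf) (nth-drop (length h ∸ length T) h i)

lastOf-suffix : ∀ {T h} → SuffixOf T h → 1 ≤ length T → lastOf T ≡ lastOf h
lastOf-suffix {T} {h} suf 1≤T = trans (nth-suffix suf (length T ∸ 1)) (cong (nth h) (∸+∸ (length h) (length T) 1 1≤T (suffix-length suf)))

swapAt : ℕ → List ℕ → List ℕ
swapAt zero    (x ∷ y ∷ xs) = y ∷ x ∷ xs
swapAt (suc i) (x ∷ xs)     = x ∷ swapAt i xs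
swapAt _       xs           = xs

moveRight : ℕ → ℕ → List ℕ → List ℕ
moveRight a zero    X = X
moveRight a (suc t) X = moveRight (suc a) t (swapAt a X)

swapAt-length : ∀ i X → length (swapAt i X) ≡ length X
swapAt-length zero    (x ∷ y ∷ X) = refl
swapAt-length zero    []          = refl
swapAt-length zero    (x ∷ [])    = refl
swapAt-length (suc i) []          = refl
swapAt-length (suc i) (x ∷ X)     = cong suc (swapAt-length i X)

swapAt-sum : ∀ i X → sum (swapAt i X) ≡ sum X
swapAt-sum zero    (x ∷ y ∷ X) = trans (sym (+-assoc y x _)) (trans (cong (_+ sum X) (+-comm y x)) (+-assoc x y _))
swapAt-sum zero    []          = refl
swapAt-sum zero    (x ∷ [])    = refl
swapAt-sum (suc i) []          = refl
swapAt-sum (suc i) (x ∷ X)     = cong (x +_) (swapAt-sum i X)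

moveRight-length : ∀ t a X → length (moveRight a t X) ≡ length X
moveRight-length zero    a X = refl
moveRight-length (suc t) a X = trans (moveRight-length t (suc a) (swapAt a X)) (swapAt-length a X)

moveRight-sum : ∀ t a X → sum (moveRight a t X) ≡ sum X
moveRight-sum zero    a X = refl
moveRight-sum (suc t) a X = trans (moveRight-sum t (suc a) (swapAt a X)) (swapAt-sum a X)

moveRight-∷ : ∀ t a x X → moveRight (suc a) t (x ∷ X) ≡ x ∷ moveRight a t X
moveRight-∷ zero    a x X = refl
moveRight-∷ (suc t) a x X = moveRight-∷ t (suc a) x (swapAt a X)

moveRight-[] : ∀ t a → moveRight a t [] ≡ []
moveRight-[] zero    a       = refl
moveRight-[] (suc t) zero    = moveRight-[] t 1
moveRight-[] (suc t) (suc a) = moveRight-[] t (suc (suc a))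

drop-moveRight : ∀ t a X → drop a (moveRight a t X) ≡ moveRight 0 t (drop a X)
drop-moveRight t zero    X       = refl
drop-moveRight t (suc a) []      = trans (cong (drop (suc a)) (moveRight-[] t (suc a))) (sym (moveRight-[] t 0))
drop-moveRight t (suc a) (x ∷ X) rewrite moveRight-∷ t a x X = drop-moveRight t a X

take-moveRight-head : ∀ t x X → t ≤ length X → take t (moveRight 0 t (x ∷ X)) ≡ take t X
take-moveRight-head zero    x X       _       = refl
take-moveRight-head (suc t) x (y ∷ X) (s≤s p) rewrite moveRight-∷ t 0 y (x ∷ X) = cong (y ∷_) (take-moveRight-head t x X p)

take-drop-moveRight : ∀ t a X → suc a + t ≤ length X → take t (drop a (moveRight a t X)) ≡ take t (drop (suc a) X)
take-drop-moveRight t a X p rewrite drop-moveRight t a X with drop a X in eq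
... | []    = ⊥-elim (m>n⇒m∸n≢0 (≤-trans (s≤s (m≤m+n a t)) p) (trans (sym (length-drop a X)) (cong length eq)))
... | y ∷ Y = trans (take-moveRight-head t y Y t≤Y) (cong (take t) (sym (drop-suc a X eq)))
  where
    drop-suc : ∀ a (X : List ℕ) {y Y} → drop a X ≡ y ∷ Y → drop (suc a) X ≡ Y
    drop-suc zero    (x ∷ X) refl = refl
    drop-suc (suc a) (x ∷ X) e    = drop-suc a X e
    t≤Y : t ≤ length Y
    t≤Y = s≤s⁻¹ (subst (suc t ≤_) (trans (sym (length-drop a X)) (cong length eq))
            (m+n≤o⇒m≤o∸n (suc t) (subst (_≤ length X) (cong suc (+-comm a t)) p)))

-- tupleSum N U φ is the sum of φ over all lists of N positive numbers with sum at most U.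
tupleSum : ℕ → ℕ → (List ℕ → ℕ) → ℕ
tupleSum zero    U φ = φ []
tupleSum (suc N) U φ = sumBelow (λ d → tupleSum N (U ∸ suc d) (λ X → φ (suc d ∷ X))) U

tupleSum-cong : ∀ N U {φ ψ} → (∀ X → length X ≡ N → φ X ≡ ψ X) → tupleSum N U φ ≡ tupleSum N U ψ
tupleSum-cong zero    U h = h [] refl
tupleSum-cong (suc N) U h =
  sumBelow-cong′ U (λ d → tupleSum-cong N (U ∸ suc d) (λ X e → h (suc d ∷ X) (cong suc e)))

tupleSum-swapAt : ∀ i N U φ → tupleSum N U φ ≡ tupleSum N U (λ X → φ (swapAt i X))
tupleSum-swapAt zero zero U φ = refl
tupleSum-swapAt zero (suc zero) U φ = refl
tupleSum-swapAt zero (suc (suc N)) U φ =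
  trans (sumBelow-triangle-comm U (λ i j → tupleSum N (U ∸ suc i ∸ suc j) (λ X → φ (suc i ∷ suc j ∷ X))))
        (sumBelow-cong′ U (λ i → sumBelow-cong′ (U ∸ suc i) (λ j →
          cong (λ V → tupleSum N V (λ X → φ (suc j ∷ suc i ∷ X))) (∸-swap U (suc j) (suc i)))))
tupleSum-swapAt (suc i) zero U φ = refl
tupleSum-swapAt (suc i) (suc N) U φ =
  sumBelow-cong′ U (λ d → tupleSum-swapAt i N (U ∸ suc d) (λ X → φ (suc d ∷ X)))

tupleSum-moveRight : ∀ t a N U φ → tupleSum N U φ ≡ tupleSum N U (λ X → φ (moveRight a t X))
tupleSum-moveRight zero    a N U φ = refl
tupleSum-moveRight (suc t) a N U φ =
  trans (tupleSum-moveRight t (suc a) N U φ) (tupleSum-swapAt a N U (λ X → φ (moveRight (suc a) t X)))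

between : ℕ → ℕ → ℕ → Bool
between lo hi z = (lo <ᵇ z) ∧ (z <ᵇ hi)

between-below : ∀ {lo hi z} → z ≤ lo → between lo hi z ≡ false
between-below z≤lo rewrite <ᵇ-false z≤lo = refl

between-above : ∀ {lo hi z} → hi ≤ z → between lo hi z ≡ false
between-above {lo} {hi} {z} hi≤z rewrite <ᵇ-false hi≤z with lo <ᵇ z
... | true  = refl
... | false = refl

between-inside : ∀ {lo hi z} → lo < z → z < hi → between lo hi z ≡ true
between-inside lo<z z<hi rewrite <ᵇ-true lo<z | <ᵇ-true z<hi = refl

sumBelow-between : ∀ f lo hi x → suc lo ≤ hi → hi ≤ x →
  sumBelow f (suc lo) + sumBelow (λ z → if between lo hi z then f z else 0) x ≡ sumBelow f hi
sumBelow-between f lo hi x lo<hi hi≤x = begin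
    sumBelow f (suc lo) + sumBelow g x
  ≡⟨ cong (sumBelow f (suc lo) +_) (trans upToX upToHi) ⟩
    sumBelow f (suc lo) + sumBelow (λ i → f (suc lo + i)) m
  ≡⟨ sumBelow-+ f (suc lo) m ⟨
    sumBelow f (suc lo + m)
  ≡⟨ cong (sumBelow f) (m+[n∸m]≡n lo<hi) ⟩
    sumBelow f hi ∎
  where
    open ≡-Reasoning
    g : ℕ → ℕ
    g z = if between lo hi z then f z else 0
    m : ℕ
    m = hi ∸ suc lo
    upToX : sumBelow g x ≡ sumBelow g hi
    upToX = begin
        sumBelow g x
      ≡⟨ cong (sumBelow g) (m+[n∸m]≡n hi≤x) ⟨
        sumBelow g (hi + (x ∸ hi))
      ≡⟨ sumBelow-+ g hi (x ∸ hi) ⟩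
        sumBelow g hi + sumBelow (λ i → g (hi + i)) (x ∸ hi)
      ≡⟨ cong (sumBelow g hi +_) (sumBelow-cong′ (x ∸ hi) (λ i → cong (if_then f (hi + i) else 0) (between-above (m≤m+n hi i)))) ⟩
        sumBelow g hi + sumBelow (λ _ → 0) (x ∸ hi)
      ≡⟨ cong (sumBelow g hi +_) (sumBelow-zero (x ∸ hi)) ⟩
        sumBelow g hi + 0
      ≡⟨ +-identityʳ _ ⟩
        sumBelow g hi ∎
    upToHi : sumBelow g hi ≡ sumBelow (λ i → f (suc lo + i)) m
    upToHi = begin
        sumBelow g hi
      ≡⟨ cong (sumBelow g) (m+[n∸m]≡n lo<hi) ⟨
        sumBelow g (suc lo + m)
      ≡⟨ sumBelow-+ g (suc lo) m ⟩
        sumBelow g (suc lo) + sumBelow (λ i → g (suc lo + i)) m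
      ≡⟨ cong₂ _+_ (sumBelow-cong (suc lo) (λ z z<1+lo → cong (if_then f z else 0) (between-below {hi = hi} (s≤s⁻¹ z<1+lo))))
                   (sumBelow-cong m (λ i i<m → cong (if_then f (suc lo + i) else 0) (between-inside (s≤s (m≤m+n lo i)) (inside i i<m)))) ⟩
        sumBelow (λ _ → 0) (suc lo) + sumBelow (λ i → f (suc lo + i)) m
      ≡⟨ cong (_+ sumBelow (λ i → f (suc lo + i)) m) (sumBelow-zero (suc lo)) ⟩
        sumBelow (λ i → f (suc lo + i)) m ∎
      where
        inside : ∀ i → i < m → suc lo + i < hi
        inside i i<m = subst (_≤ hi) (cong suc (+-comm i (suc lo))) (m≤o∸n⇒m+n≤o (suc i) lo<hi i<m)

notIn : (ℕ → Bool) → ℕ → ℕ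
notIn F z = if F z then 0 else 1

rank : (ℕ → Bool) → ℕ → ℕ
rank F x = sumBelow (notIn F) x

rank-suc : ∀ F {x} → F x ≡ false → rank F (suc x) ≡ suc (rank F x)
rank-suc F Fx rewrite Fx = +-comm _ 1

rank-mono : ∀ F {x y} → x ≤ y → rank F x ≤ rank F y
rank-mono F {x} {y} x≤y = subst (λ z → rank F x ≤ rank F z) (m+[n∸m]≡n x≤y)
  (subst (rank F x ≤_) (sym (sumBelow-+ (notIn F) x (y ∸ x))) (m≤m+n _ _))

rank-< : ∀ F {x y} → F x ≡ false → x < y → rank F x < rank F y
rank-< F Fx x<y = ≤-trans (≤-reflexive (sym (rank-suc F Fx))) (rank-mono F x<y)

rank-<ᵇ : ∀ F x y → F x ≡ false → F y ≡ false → (x <ᵇ y) ≡ (rank F x <ᵇ rank F y)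
rank-<ᵇ F x y Fx Fy with x <? y
... | yes x<y = trans (<ᵇ-true x<y) (sym (<ᵇ-true (rank-< F Fx x<y)))
... | no x≮y  = trans (<ᵇ-false (≮⇒≥ x≮y)) (sym (<ᵇ-false (rank-mono F (≮⇒≥ x≮y))))

rank-cong : ∀ F G x → (∀ z → z < x → F z ≡ G z) → rank F x ≡ rank G x
rank-cong F G x h = sumBelow-cong x (λ z z<x → cong (if_then 0 else 1) (h z z<x))

sumBelow-byRank : ∀ F (G : ℕ → ℕ) k → sumBelow (λ x → if F x then 0 else G (rank F x)) k ≡ sumBelow G (rank F k)
sumBelow-byRank F G zero = refl
sumBelow-byRank F G (suc k) with F k
... | true  = trans (+-identityʳ _) (trans (sumBelow-byRank F G k) (cong (sumBelow G) (sym (+-identityʳ (rank F k)))))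
... | false = trans (cong (_+ G (rank F k)) (sumBelow-byRank F G k)) (cong (sumBelow G) (sym (+-comm (rank F k) 1)))

withGap : (ℕ → Bool) → ℕ → ℕ → ℕ → Bool
withGap F lo hi z = F z ∨ between lo hi z

rank-withGap-above : ∀ F lo hi x → lo < hi → F lo ≡ false → hi ≤ x →
  rank F x ≡ rank (withGap F lo hi) x + (rank F hi ∸ suc (rank F lo))
rank-withGap-above F lo hi x lo<hi Flo hi≤x = begin
    rank F x
  ≡⟨ sumBelow-cong′ x split ⟩
    sumBelow (λ z → notIn (withGap F lo hi) z + cut z) x
  ≡⟨ sumBelow-distrib-+ (notIn (withGap F lo hi)) cut x ⟩
    rank (withGap F lo hi) x + sumBelow cut x
  ≡⟨ cong (rank (withGap F lo hi) x +_) (sym (trans (cong (_∸ rank F (suc lo)) (sym inGap)) (m+n∸m≡n (rank F (suc lo)) _))) ⟩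
    rank (withGap F lo hi) x + (rank F hi ∸ rank F (suc lo))
  ≡⟨ cong (λ y → rank (withGap F lo hi) x + (rank F hi ∸ y)) (rank-suc F Flo) ⟩
    rank (withGap F lo hi) x + (rank F hi ∸ suc (rank F lo)) ∎
  where
    open ≡-Reasoning
    cut : ℕ → ℕ
    cut z = if between lo hi z then notIn F z else 0
    split : ∀ z → notIn F z ≡ notIn (withGap F lo hi) z + cut z
    split z with F z | between lo hi z
    ... | true  | true  = refl
    ... | true  | false = refl
    ... | false | true  = refl
    ... | false | false = refl
    inGap : rank F (suc lo) + sumBelow cut x ≡ rank F hi
    inGap = sumBelow-between (notIn F) lo hi x lo<hi hi≤x

toWord : ∀ {k n} → Vec (Fin k) n → List ℕ
toWord v = toList (V.map toℕ v)

countWords : (List ℕ → Bool) → ℕ → ℕ → ℕ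
countWords P n k = length (filterᵇ (λ v → P (toWord v)) (words n k))

countWords-cong : ∀ {P Q} n k → (∀ w → P w ≡ Q w) → countWords P n k ≡ countWords Q n k
countWords-cong {P} {Q} n k P≗Q = cong length (go (words n k))
  where
    go : ∀ {m} (vs : List (Vec (Fin k) m)) → filterᵇ (λ v → P (toWord v)) vs ≡ filterᵇ (λ v → Q (toWord v)) vs
    go [] = refl
    go (v ∷ vs) rewrite P≗Q (toWord v) with Q (toWord v)
    ... | true  = cong (v ∷_) (go vs)
    ... | false = go vs

length-filterᵇ-concatMap : ∀ {A B : Set} (P : B → Bool) (f : A → List B) xs →
  length (filterᵇ P (concatMap f xs)) ≡ sum (map (λ x → length (filterᵇ P (f x))) xs)
length-filterᵇ-concatMap P f []       = refl
length-filterᵇ-concatMap P f (x ∷ xs) =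
  trans (cong length (filter-++ (λ y → T? (P y)) (f x) (concatMap f xs)))
        (trans (length-++ (filterᵇ P (f x))) (cong (length (filterᵇ P (f x)) +_) (length-filterᵇ-concatMap P f xs)))

length-filterᵇ-map : ∀ {A B : Set} (P : B → Bool) (f : A → B) xs →
  length (filterᵇ P (map f xs)) ≡ length (filterᵇ (λ x → P (f x)) xs)
length-filterᵇ-map P f []       = refl
length-filterᵇ-map P f (x ∷ xs) with P (f x)
... | true  = cong suc (length-filterᵇ-map P f xs)
... | false = length-filterᵇ-map P f xs

sum-tabulate-toℕ : ∀ k (g : ℕ → ℕ) → sum (tabulate {n = k} (λ i → g (toℕ i))) ≡ sumBelow g k
sum-tabulate-toℕ zero    g = refl
sum-tabulate-toℕ (suc k) g = trans (cong (g 0 +_) (sum-tabulate-toℕ k (λ i → g (suc i)))) (sym (sumBelow-sucˡ g k))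

countWords-suc : ∀ P n k → countWords P (suc n) k ≡ sumBelow (λ x → countWords (λ w → P (x ∷ w)) n k) k
countWords-suc P n k = begin
    length (filterᵇ Q (concatMap (λ b → map (b V.∷_) (words n k)) (allFin k)))
  ≡⟨ length-filterᵇ-concatMap Q (λ b → map (b V.∷_) (words n k)) (allFin k) ⟩
    sum (map (λ b → length (filterᵇ Q (map (b V.∷_) (words n k)))) (allFin k))
  ≡⟨ cong sum (map-tabulate {n = k} (λ b → b) _) ⟩
    sum (tabulate {n = k} (λ b → length (filterᵇ Q (map (b V.∷_) (words n k)))))
  ≡⟨ cong sum (tabulate-cong (λ b → length-filterᵇ-map Q (b V.∷_) (words n k))) ⟩
    sum (tabulate {n = k} (λ b → countWords (λ w → P (toℕ b ∷ w)) n k))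
  ≡⟨ sum-tabulate-toℕ k (λ x → countWords (λ w → P (x ∷ w)) n k) ⟩
    sumBelow (λ x → countWords (λ w → P (x ∷ w)) n k) k ∎
  where
    open ≡-Reasoning
    Q : ∀ {m} → Vec (Fin k) m → Bool
    Q v = P (toWord v)

countWords-false : ∀ n k → countWords (λ _ → false) n k ≡ 0
countWords-false n k = cong length (filter-none (λ _ → T? false) (All.universal (λ _ ()) (words n k)))

orderIso?-sound : ∀ A B → orderIso? A B ≡ true → reduce A ≡ reduce B
orderIso?-sound A B e with ≡-dec _≟_ (reduce A) (reduce B)
... | yes p = p
... | no  _ = contradiction e λ ()

orderIso?-complete : ∀ A B → reduce A ≡ reduce B → orderIso? A B ≡ true
orderIso?-complete A B e with ≡-dec _≟_ (reduce A) (reduce B)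
... | yes _ = refl
... | no ¬e = ⊥-elim (¬e e)

memberᵇ : List ℕ → ℕ → Bool
memberᵇ M y = any (λ z → y ≡ᵇ z) M

rankIn : List ℕ → ℕ → ℕ
rankIn M x = length (filterᵇ (memberᵇ M) (upTo x))

rankIn-suc : ∀ M x → rankIn M (suc x) ≡ rankIn M x + (if memberᵇ M x then 1 else 0)
rankIn-suc M x = begin
    length (filterᵇ (memberᵇ M) (upTo (suc x)))
  ≡⟨ cong (λ l → length (filterᵇ (memberᵇ M) l)) (upTo-∷ʳ x) ⟨
    length (filterᵇ (memberᵇ M) (upTo x ∷ʳ x))
  ≡⟨ cong length (filter-++ (λ y → T? (memberᵇ M y)) (upTo x) (x ∷ [])) ⟩
    length (filterᵇ (memberᵇ M) (upTo x) ++ filterᵇ (memberᵇ M) (x ∷ []))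
  ≡⟨ length-++ (filterᵇ (memberᵇ M) (upTo x)) ⟩
    rankIn M x + length (filterᵇ (memberᵇ M) (x ∷ []))
  ≡⟨ cong (rankIn M x +_) last ⟩
    rankIn M x + (if memberᵇ M x then 1 else 0) ∎
  where
    open ≡-Reasoning
    last : length (filterᵇ (memberᵇ M) (x ∷ [])) ≡ (if memberᵇ M x then 1 else 0)
    last with memberᵇ M x
    ... | true  = refl
    ... | false = refl

rankIn-rank : ∀ M x → rankIn M x ≡ rank (λ y → not (memberᵇ M y)) x
rankIn-rank M zero    = refl
rankIn-rank M (suc x) = trans (rankIn-suc M x) (cong₂ _+_ (rankIn-rank M x) indicator)
  where
    indicator : (if memberᵇ M x then 1 else 0) ≡ notIn (λ y → not (memberᵇ M y)) x
    indicator with memberᵇ M x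
    ... | true  = refl
    ... | false = refl

rankIn-<ᵇ : ∀ M x y → memberᵇ M x ≡ true → memberᵇ M y ≡ true → (x <ᵇ y) ≡ (rankIn M x <ᵇ rankIn M y)
rankIn-<ᵇ M x y x∈M y∈M =
  trans (rank-<ᵇ (λ z → not (memberᵇ M z)) x y (cong not x∈M) (cong not y∈M))
        (sym (cong₂ _<ᵇ_ (rankIn-rank M x) (rankIn-rank M y)))

memberᵇ-nth : ∀ M i → i < length M → memberᵇ M (nth M i) ≡ true
memberᵇ-nth (z ∷ M) zero    _       rewrite ≡ᵇ-true (refl {x = z}) = refl
memberᵇ-nth (z ∷ M) (suc i) (s≤s p) rewrite memberᵇ-nth M i p = ∨-zeroʳ _

nth-map : ∀ (f : ℕ → ℕ) M i → i < length M → nth (map f M) i ≡ f (nth M i)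
nth-map f (x ∷ M) zero    _       = refl
nth-map f (x ∷ M) (suc i) (s≤s p) = nth-map f M i p

nth-reduce : ∀ M i → i < length M → nth (reduce M) i ≡ suc (rankIn M (nth M i))
nth-reduce M i i<M = nth-map _ M i i<M

SameOrder : List ℕ → List ℕ → Set
SameOrder A B = ∀ i j → i < length A → j < length A → (nth A i <ᵇ nth A j) ≡ (nth B i <ᵇ nth B j)

reduce⇒SameOrder : ∀ A B → length A ≡ length B → reduce A ≡ reduce B → SameOrder A B
reduce⇒SameOrder A B |A|≡|B| e i j i<A j<A = begin
    (nth A i <ᵇ nth A j)
  ≡⟨ rankIn-<ᵇ A (nth A i) (nth A j) (memberᵇ-nth A i i<A) (memberᵇ-nth A j j<A) ⟩
    (rankIn A (nth A i) <ᵇ rankIn A (nth A j))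
  ≡⟨ cong₂ _<ᵇ_ (sameRank i i<A) (sameRank j j<A) ⟩
    (rankIn B (nth B i) <ᵇ rankIn B (nth B j))
  ≡⟨ rankIn-<ᵇ B (nth B i) (nth B j) (memberᵇ-nth B i (i<B i<A)) (memberᵇ-nth B j (i<B j<A)) ⟨
    (nth B i <ᵇ nth B j) ∎
  where
    open ≡-Reasoning
    i<B : ∀ {i} → i < length A → i < length B
    i<B = subst (_ <_) |A|≡|B|
    sameRank : ∀ i → i < length A → rankIn A (nth A i) ≡ rankIn B (nth B i)
    sameRank i i<A = suc-injective (trans (sym (nth-reduce A i i<A)) (trans (cong (λ l → nth l i) e) (nth-reduce B i (i<B i<A))))

Distinct : List ℕ → Set
Distinct M = ∀ i j → i < length M → j < length M → nth M i ≡ nth M j → i ≡ j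

Distinct-tail : ∀ {y M} → Distinct (y ∷ M) → Distinct M
Distinct-tail dist i j i<M j<M e = suc-injective (dist (suc i) (suc j) (s≤s i<M) (s≤s j<M) e)

countBelow : List ℕ → ℕ → ℕ
countBelow M x = length (filterᵇ (λ y → y <ᵇ x) M)

countEqual : List ℕ → ℕ → ℕ
countEqual M x = length (filterᵇ (λ y → x ≡ᵇ y) M)

countBelow-zero : ∀ M → countBelow M 0 ≡ 0
countBelow-zero []      = refl
countBelow-zero (y ∷ M) = countBelow-zero M

countBelow-suc : ∀ M x → countBelow M (suc x) ≡ countBelow M x + countEqual M x
countBelow-suc []      x = refl
countBelow-suc (y ∷ M) x with <-cmp y x
... | tri< y<x _ _ rewrite <ᵇ-true (<-trans y<x (n<1+n x)) | <ᵇ-true y<x | ≡ᵇ-false (<⇒≢ y<x ∘ sym) =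
  cong suc (countBelow-suc M x)
... | tri≈ _ refl _ rewrite <ᵇ-true (n<1+n y) | <ᵇ-false (≤-refl {y}) | ≡ᵇ-true (refl {x = y}) =
  trans (cong suc (countBelow-suc M y)) (sym (+-suc _ _))
... | tri> _ _ x<y rewrite <ᵇ-false x<y | <ᵇ-false (<⇒≤ x<y) | ≡ᵇ-false (<⇒≢ x<y) = countBelow-suc M x

memberᵇ-absent : ∀ M x → (∀ j → j < length M → nth M j ≢ x) → memberᵇ M x ≡ false
memberᵇ-absent []      x _      = refl
memberᵇ-absent (y ∷ M) x absent rewrite ≡ᵇ-false (λ x≡y → absent 0 (s≤s z≤n) (sym x≡y)) =
  memberᵇ-absent M x (λ j j<M → absent (suc j) (s≤s j<M))

countEqual-distinct : ∀ M x → Distinct M → countEqual M x ≡ (if memberᵇ M x then 1 else 0)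
countEqual-distinct []      x _ = refl
countEqual-distinct (y ∷ M) x dist with x ≡ᵇ y in x≡ᵇy
... | false = countEqual-distinct M x (Distinct-tail dist)
... | true rewrite sym (≡ᵇ⇒≡ x y (subst T (sym x≡ᵇy) _)) | countEqual-distinct M x (Distinct-tail dist)
                 | memberᵇ-absent M x (λ j j<M e → 0≢1+n (dist 0 (suc j) (s≤s z≤n) (s≤s j<M) (sym e))) = refl

rankIn-distinct : ∀ M x → Distinct M → rankIn M x ≡ countBelow M x
rankIn-distinct M zero    dist = sym (countBelow-zero M)
rankIn-distinct M (suc x) dist =
  trans (rankIn-suc M x) (trans (cong₂ _+_ (rankIn-distinct M x dist) (sym (countEqual-distinct M x dist))) (sym (countBelow-suc M x)))

length-filterᵇ-pointwise : ∀ A B (p q : ℕ → Bool) → length A ≡ length B →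
  (∀ j → j < length A → p (nth A j) ≡ q (nth B j)) → length (filterᵇ p A) ≡ length (filterᵇ q B)
length-filterᵇ-pointwise []      []      p q _ _ = refl
length-filterᵇ-pointwise (x ∷ A) (y ∷ B) p q |A|≡|B| pq rewrite pq 0 (s≤s z≤n) with q y
... | true  = cong suc (length-filterᵇ-pointwise A B p q (suc-injective |A|≡|B|) (λ j j<A → pq (suc j) (s≤s j<A)))
... | false = length-filterᵇ-pointwise A B p q (suc-injective |A|≡|B|) (λ j j<A → pq (suc j) (s≤s j<A))

nth-ext : ∀ (xs ys : List ℕ) → length xs ≡ length ys → (∀ i → i < length xs → nth xs i ≡ nth ys i) → xs ≡ ys
nth-ext []       []       _       _ = refl
nth-ext (x ∷ xs) (y ∷ ys) |xs|≡|ys| e =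
  cong₂ _∷_ (e 0 (s≤s z≤n)) (nth-ext xs ys (suc-injective |xs|≡|ys|) (λ i i<xs → e (suc i) (s≤s i<xs)))

SameOrder-Distinct : ∀ A B → length A ≡ length B → SameOrder A B → Distinct B → Distinct A
SameOrder-Distinct A B |A|≡|B| same distB i j i<A j<A Ai≡Aj =
  distB i j (subst (i <_) |A|≡|B| i<A) (subst (j <_) |A|≡|B| j<A) (≮∧≯⇒≡ i≮j j≮i)
  where
    ≮∧≯⇒≡ : ∀ {m n} → (m <ᵇ n) ≡ false → (n <ᵇ m) ≡ false → m ≡ n
    ≮∧≯⇒≡ m≮n n≮m = ≤-antisym (<ᵇ-false⁻¹ n≮m) (<ᵇ-false⁻¹ m≮n)
    i≮j : (nth B i <ᵇ nth B j) ≡ false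
    i≮j = trans (sym (same i j i<A j<A)) (<ᵇ-false (≤-reflexive (sym Ai≡Aj)))
    j≮i : (nth B j <ᵇ nth B i) ≡ false
    j≮i = trans (sym (same j i j<A i<A)) (<ᵇ-false (≤-reflexive Ai≡Aj))

SameOrder⇒reduce : ∀ A B → length A ≡ length B → SameOrder A B → Distinct B → reduce A ≡ reduce B
SameOrder⇒reduce A B |A|≡|B| same distB =
  nth-ext (reduce A) (reduce B) (trans (length-map _ A) (trans |A|≡|B| (sym (length-map _ B)))) λ i i<rA →
    let i<A = subst (i <_) (length-map _ A) i<rA in begin
      nth (reduce A) i                ≡⟨ nth-reduce A i i<A ⟩
      suc (rankIn A (nth A i))        ≡⟨ cong suc (rankIn-distinct A (nth A i) distA) ⟩
      suc (countBelow A (nth A i))    ≡⟨ cong suc (length-filterᵇ-pointwise A B _ _ |A|≡|B| (λ j j<A → same j i j<A i<A)) ⟩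
      suc (countBelow B (nth B i))    ≡⟨ cong suc (rankIn-distinct B (nth B i) distB) ⟨
      suc (rankIn B (nth B i))        ≡⟨ nth-reduce B i (subst (i <_) |A|≡|B| i<A) ⟨
      nth (reduce B) i                ∎
  where
    open ≡-Reasoning
    distA : Distinct A
    distA = SameOrder-Distinct A B |A|≡|B| same distB

applyUpTo-+ : ∀ (f : ℕ → ℕ) m n → applyUpTo f (m + n) ≡ applyUpTo f m ++ applyUpTo (λ i → f (m + i)) n
applyUpTo-+ f zero    n = refl
applyUpTo-+ f (suc m) n = cong (f 0 ∷_) (applyUpTo-+ (λ i → f (suc i)) m n)

filterᵇ-applyUpTo-all : ∀ (p : ℕ → Bool) f n → (∀ i → i < n → p (f i) ≡ true) → filterᵇ p (applyUpTo f n) ≡ applyUpTo f n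
filterᵇ-applyUpTo-all p f n all = filter-all (λ y → T? (p y)) (applyUpTo⁺₁ f n (λ {i} i<n → subst T (sym (all i i<n)) _))

nth-applyUpTo : ∀ (f : ℕ → ℕ) n i → i < n → nth (applyUpTo f n) i ≡ f i
nth-applyUpTo f (suc n) zero    _       = refl
nth-applyUpTo f (suc n) (suc i) (s≤s p) = nth-applyUpTo (λ j → f (suc j)) n i p

module Pattern (r a : ℕ) (a+2≤r : a + 2 ≤ r) where

  u : ℕ
  u = suc (suc a)

  P : List ℕ
  P = vpattern r u

  a<r : a < r
  a<r = ≤-trans (≤-trans (n≤1+n (suc a)) (≤-reflexive (+-comm 2 a))) a+2≤r

  1+a<r : suc a < r
  1+a<r = subst (_≤ r) (+-comm a 2) a+2≤r

  t : ℕ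
  t = r ∸ suc a

  1+a+t≡r : suc a + t ≡ r
  1+a+t≡r = m+[n∸m]≡n a<r

  front : List ℕ
  front = applyUpTo suc (suc a) ++ applyUpTo (λ i → suc (suc a + suc i)) t

  P≡front∷ʳu : P ≡ front ∷ʳ u
  P≡front∷ʳu = cong (_∷ʳ u) (begin
      filterᵇ p (applyUpTo suc (suc r))
    ≡⟨ cong (λ z → filterᵇ p (applyUpTo suc z)) (sym (trans (+-suc (suc a) t) (cong suc 1+a+t≡r))) ⟩
      filterᵇ p (applyUpTo suc (suc a + suc t))
    ≡⟨ cong (filterᵇ p) (applyUpTo-+ suc (suc a) (suc t)) ⟩
      filterᵇ p (applyUpTo suc (suc a) ++ applyUpTo (λ i → suc (suc a + i)) (suc t))
    ≡⟨ filter-++ (λ y → T? (p y)) (applyUpTo suc (suc a)) _ ⟩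
      filterᵇ p (applyUpTo suc (suc a)) ++ filterᵇ p (applyUpTo (λ i → suc (suc a + i)) (suc t))
    ≡⟨ cong₂ _++_ (filterᵇ-applyUpTo-all p suc (suc a) below) above ⟩
      front ∎)
    where
      open ≡-Reasoning
      p : ℕ → Bool
      p i = not (i ≡ᵇ u)
      below : ∀ i → i < suc a → p (suc i) ≡ true
      below i i≤a rewrite ≡ᵇ-false {suc i} {u} (λ e → <-irrefl (suc-injective e) i≤a) = refl
      above : filterᵇ p (applyUpTo (λ i → suc (suc a + i)) (suc t)) ≡ applyUpTo (λ i → suc (suc a + suc i)) t
      above rewrite +-identityʳ a | ≡ᵇ-true (refl {x = a}) = filterᵇ-applyUpTo-all p (λ i → suc (suc a + suc i)) t λ i _ →
        cong not (≡ᵇ-false (λ e → 0≢1+n (sym (+-cancelˡ-≡ a (suc i) 0 (trans (suc-injective (suc-injective e)) (sym (+-identityʳ a)))))))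

  length-front : length front ≡ r
  length-front = trans (length-++ (applyUpTo suc (suc a)))
                       (trans (cong₂ _+_ (length-applyUpTo suc (suc a)) (length-applyUpTo _ t)) 1+a+t≡r)

  length-P : length P ≡ suc r
  length-P = trans (cong length P≡front∷ʳu) (trans (length-∷ʳ front u) (cong suc length-front))

  nth-P-low : ∀ i → i < suc a → nth P i ≡ suc i
  nth-P-low i i≤a = begin
      nth P i
    ≡⟨ cong (λ l → nth l i) P≡front∷ʳu ⟩
      nth (front ∷ʳ u) i
    ≡⟨ nth-++ˡ front (u ∷ []) i (subst (i <_) (sym length-front) (≤-trans i≤a a<r)) ⟩
      nth front i
    ≡⟨ nth-++ˡ (applyUpTo suc (suc a)) _ i (subst (i <_) (sym (length-applyUpTo suc (suc a))) i≤a) ⟩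
      nth (applyUpTo suc (suc a)) i
    ≡⟨ nth-applyUpTo suc (suc a) i i≤a ⟩
      suc i ∎
    where open ≡-Reasoning

  nth-P-high : ∀ i → suc a ≤ i → i < r → nth P i ≡ suc (suc i)
  nth-P-high i a<i i<r = begin
      nth P i
    ≡⟨ cong (λ l → nth l i) P≡front∷ʳu ⟩
      nth (front ∷ʳ u) i
    ≡⟨ nth-++ˡ front (u ∷ []) i (subst (i <_) (sym length-front) i<r) ⟩
      nth front i
    ≡⟨ cong (nth front) (trans (cong (_+ i′) (length-applyUpTo suc (suc a))) (m+[n∸m]≡n a<i)) ⟨
      nth front (length (applyUpTo suc (suc a)) + i′)
    ≡⟨ nth-++ʳ (applyUpTo suc (suc a)) _ i′ ⟩
      nth (applyUpTo (λ j → suc (suc a + suc j)) t) i′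
    ≡⟨ nth-applyUpTo _ t i′ (∸-monoˡ-< i<r a<i) ⟩
      suc (suc a + suc i′)
    ≡⟨ cong suc (+-suc (suc a) i′) ⟩
      suc (suc (suc a + i′))
    ≡⟨ cong (λ z → suc (suc z)) (m+[n∸m]≡n a<i) ⟩
      suc (suc i) ∎
    where
      open ≡-Reasoning
      i′ : ℕ
      i′ = i ∸ suc a

  nth-P-last : nth P r ≡ u
  nth-P-last = trans (cong (λ l → nth l r) P≡front∷ʳu) (trans (cong (nth (front ∷ʳ u)) (sym length-front)) (nth-∷ʳ-last front u))

  record Shaped (X : List ℕ) : Set where
    field
      length≡    : length X ≡ suc r
      increasing : ∀ i j → i < j → j < r → nth X i < nth X j
      above-a    : nth X a < nth X r
      below-1+a  : nth X r < nth X (suc a)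

  Shaped-P : Shaped P
  Shaped-P = record { length≡ = length-P ; increasing = increasing ; above-a = above-a ; below-1+a = below-1+a }
    where
      increasing : ∀ i j → i < j → j < r → nth P i < nth P j
      increasing i j i<j j<r with i <? suc a | j <? suc a
      ... | yes i≤a | yes j≤a rewrite nth-P-low i i≤a | nth-P-low j j≤a = s≤s i<j
      ... | yes i≤a | no  j≰a rewrite nth-P-low i i≤a | nth-P-high j (≮⇒≥ j≰a) j<r = s≤s (≤-trans i<j (n≤1+n j))
      ... | no  i≰a | yes j≤a = ⊥-elim (i≰a (<-trans i<j j≤a))
      ... | no  i≰a | no  j≰a rewrite nth-P-high i (≮⇒≥ i≰a) (<-trans i<j j<r) | nth-P-high j (≮⇒≥ j≰a) j<r = s≤s (s≤s i<j)
      above-a : nth P a < nth P r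
      above-a rewrite nth-P-low a ≤-refl | nth-P-last = ≤-refl
      below-1+a : nth P r < nth P (suc a)
      below-1+a rewrite nth-P-last | nth-P-high (suc a) ≤-refl 1+a<r = ≤-refl

  order : ℕ → ℕ → Bool
  order i j = if i <ᵇ r then (if j <ᵇ r then i <ᵇ j else i <ᵇ suc a) else (if j <ᵇ r then a <ᵇ j else false)

  module _ {X : List ℕ} (S : Shaped X) where
    open Shaped S

    increasing-≤ : ∀ i j → i ≤ j → j < r → nth X i ≤ nth X j
    increasing-≤ i j i≤j j<r with m≤n⇒m<n∨m≡n i≤j
    ... | inj₁ i<j  = <⇒≤ (increasing i j i<j j<r)
    ... | inj₂ refl = ≤-refl

    Shaped-order : ∀ i j → i ≤ r → j ≤ r → (nth X i <ᵇ nth X j) ≡ order i j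
    Shaped-order i j i≤r j≤r with m≤n⇒m<n∨m≡n i≤r | m≤n⇒m<n∨m≡n j≤r
    ... | inj₁ i<r | inj₁ j<r rewrite <ᵇ-true i<r | <ᵇ-true j<r with i <? j
    ...   | yes i<j rewrite <ᵇ-true i<j = <ᵇ-true (increasing i j i<j j<r)
    ...   | no  i≮j rewrite <ᵇ-false (≮⇒≥ i≮j) = <ᵇ-false (increasing-≤ j i (≮⇒≥ i≮j) i<r)
    Shaped-order i j i≤r j≤r | inj₁ i<r | inj₂ refl rewrite <ᵇ-true i<r | <ᵇ-false (≤-refl {r}) with i <? suc a
    ...   | yes i≤a rewrite <ᵇ-true i≤a = <ᵇ-true (≤-<-trans (increasing-≤ i a (s≤s⁻¹ i≤a) a<r) above-a)
    ...   | no  i≰a rewrite <ᵇ-false (≮⇒≥ i≰a) = <ᵇ-false (<⇒≤ (<-≤-trans below-1+a (increasing-≤ (suc a) i (≮⇒≥ i≰a) i<r)))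
    Shaped-order i j i≤r j≤r | inj₂ refl | inj₁ j<r rewrite <ᵇ-false (≤-refl {r}) | <ᵇ-true j<r with a <? j
    ...   | yes a<j rewrite <ᵇ-true a<j = <ᵇ-true (<-≤-trans below-1+a (increasing-≤ (suc a) j a<j j<r))
    ...   | no  a≮j rewrite <ᵇ-false (≮⇒≥ a≮j) = <ᵇ-false (<⇒≤ (≤-<-trans (increasing-≤ j a (≮⇒≥ a≮j) a<r) above-a))
    Shaped-order i j i≤r j≤r | inj₂ refl | inj₂ refl rewrite <ᵇ-false (≤-refl {r}) = <ᵇ-false (≤-refl {nth X i})

  order-antisym : ∀ i j → i ≤ r → j ≤ r → order i j ≡ false → order j i ≡ false → i ≡ j
  order-antisym i j i≤r j≤r ¬ij ¬ji with m≤n⇒m<n∨m≡n i≤r | m≤n⇒m<n∨m≡n j≤r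
  ... | inj₁ i<r | inj₁ j<r rewrite <ᵇ-true i<r | <ᵇ-true j<r = ≤-antisym (<ᵇ-false⁻¹ ¬ji) (<ᵇ-false⁻¹ ¬ij)
  ... | inj₁ i<r | inj₂ refl rewrite <ᵇ-true i<r | <ᵇ-false (≤-refl {r}) =
    contradiction (≤-trans (<ᵇ-false⁻¹ {i} {suc a} ¬ij) (<ᵇ-false⁻¹ ¬ji)) (<-irrefl refl)
  ... | inj₂ refl | inj₁ j<r rewrite <ᵇ-true j<r | <ᵇ-false (≤-refl {r}) =
    contradiction (≤-trans (<ᵇ-false⁻¹ {j} {suc a} ¬ji) (<ᵇ-false⁻¹ ¬ij)) (<-irrefl refl)
  ... | inj₂ refl | inj₂ refl = refl

  Shaped-Distinct : ∀ {X} → Shaped X → Distinct X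
  Shaped-Distinct {X} S i j i<X j<X Xi≡Xj = order-antisym i j i≤r j≤r
      (trans (sym (Shaped-order S i j i≤r j≤r)) (<ᵇ-false (≤-reflexive (sym Xi≡Xj))))
      (trans (sym (Shaped-order S j i j≤r i≤r)) (<ᵇ-false (≤-reflexive Xi≡Xj)))
    where
      open Shaped S
      i≤r : i ≤ r
      i≤r = s≤s⁻¹ (subst (i <_) length≡ i<X)
      j≤r : j ≤ r
      j≤r = s≤s⁻¹ (subst (j <_) length≡ j<X)

  Shaped-SameOrder : ∀ {X Y} → Shaped X → Shaped Y → SameOrder X Y
  Shaped-SameOrder SX SY i j i<X j<X = trans (Shaped-order SX i j i≤r j≤r) (sym (Shaped-order SY i j i≤r j≤r))
    where
      open Shaped SX
      i≤r : i ≤ r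
      i≤r = s≤s⁻¹ (subst (i <_) length≡ i<X)
      j≤r : j ≤ r
      j≤r = s≤s⁻¹ (subst (j <_) length≡ j<X)

  module _ (W : List ℕ) (z : ℕ) (|W|≡r : length W ≡ r) where

    length-W∷ʳz : length (W ∷ʳ z) ≡ suc r
    length-W∷ʳz = trans (length-∷ʳ W z) (cong suc |W|≡r)

    nth-W∷ʳz : ∀ i → i < r → nth (W ∷ʳ z) i ≡ nth W i
    nth-W∷ʳz i i<r = nth-++ˡ W (z ∷ []) i (subst (i <_) (sym |W|≡r) i<r)

    nth-W∷ʳz-last : nth (W ∷ʳ z) r ≡ z
    nth-W∷ʳz-last = trans (cong (nth (W ∷ʳ z)) (sym |W|≡r)) (nth-∷ʳ-last W z)

    pattern-match : Increasing W → nth W a < z → z < nth W (suc a) → orderIso? (W ∷ʳ z) P ≡ true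
    pattern-match incW Wa<z z<Wa+1 = orderIso?-complete (W ∷ʳ z) P
      (SameOrder⇒reduce (W ∷ʳ z) P (trans length-W∷ʳz (sym length-P)) (Shaped-SameOrder shaped Shaped-P) (Shaped-Distinct Shaped-P))
      where
        shaped : Shaped (W ∷ʳ z)
        shaped = record
          { length≡    = length-W∷ʳz
          ; increasing = λ i j i<j j<r → subst₂ _<_ (sym (nth-W∷ʳz i (<-trans i<j j<r))) (sym (nth-W∷ʳz j j<r))
                                           (incW i j i<j (subst (j <_) (sym |W|≡r) j<r))
          ; above-a    = subst₂ _<_ (sym (nth-W∷ʳz a a<r)) (sym nth-W∷ʳz-last) Wa<z
          ; below-1+a  = subst₂ _<_ (sym nth-W∷ʳz-last) (sym (nth-W∷ʳz (suc a) 1+a<r)) z<Wa+1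
          }

    pattern-match⁻¹ : orderIso? (W ∷ʳ z) P ≡ true → Increasing W × nth W a < z × z < nth W (suc a)
    pattern-match⁻¹ match = incW , Wa<z , z<Wa+1
      where
        open Shaped Shaped-P
        same : SameOrder (W ∷ʳ z) P
        same = reduce⇒SameOrder (W ∷ʳ z) P (trans length-W∷ʳz (sym length-P)) (orderIso?-sound (W ∷ʳ z) P match)
        transfer : ∀ i j → i ≤ r → j ≤ r → nth P i < nth P j → nth (W ∷ʳ z) i < nth (W ∷ʳ z) j
        transfer i j i≤r j≤r Pi<Pj = <ᵇ-true⁻¹ (trans (same i j (subst (i <_) (sym length-W∷ʳz) (s≤s i≤r))
                                                               (subst (j <_) (sym length-W∷ʳz) (s≤s j≤r)))
                                                         (<ᵇ-true Pi<Pj))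
        incW : Increasing W
        incW i j i<j j<W = subst₂ _<_ (nth-W∷ʳz i i<r) (nth-W∷ʳz j j<r) (transfer i j (<⇒≤ i<r) (<⇒≤ j<r) (increasing i j i<j j<r))
          where
            j<r : j < r
            j<r = subst (j <_) |W|≡r j<W
            i<r : i < r
            i<r = <-trans i<j j<r
        Wa<z : nth W a < z
        Wa<z = subst₂ _<_ (nth-W∷ʳz a a<r) nth-W∷ʳz-last (transfer a r (<⇒≤ a<r) ≤-refl above-a)
        z<Wa+1 : z < nth W (suc a)
        z<Wa+1 = subst₂ _<_ nth-W∷ʳz-last (nth-W∷ʳz (suc a) 1+a<r) (transfer r (suc a) ≤-refl (<⇒≤ 1+a<r) below-1+a)

any-++ : ∀ (f : ℕ → Bool) xs ys → any f (xs ++ ys) ≡ any f xs ∨ any f ys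
any-++ f []       ys = refl
any-++ f (x ∷ xs) ys rewrite any-++ f xs ys = sym (∨-assoc (f x) _ _)

any-∨ : ∀ (f g : ℕ → Bool) xs → any (λ x → f x ∨ g x) xs ≡ any f xs ∨ any g xs
any-∨ f g []       = refl
any-∨ f g (x ∷ xs) rewrite any-∨ f g xs = interchange (f x) (g x) (any f xs) (any g xs)
  where
    interchange : ∀ a b c d → (a ∨ b) ∨ (c ∨ d) ≡ (a ∨ c) ∨ (b ∨ d)
    interchange true  b     c d = refl
    interchange false true  c d rewrite ∨-zeroʳ c = refl
    interchange false false c d = refl

any-upTo-suc : ∀ (f : ℕ → Bool) n → any f (upTo (suc n)) ≡ any f (upTo n) ∨ f n
any-upTo-suc f n = trans (cong (any f) (sym (upTo-∷ʳ n)))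
                         (trans (any-++ f (upTo n) (n ∷ [])) (cong (any f (upTo n) ∨_) (∨-identityʳ (f n))))

any-upTo-cong : ∀ {f g : ℕ → Bool} n → (∀ i → i < n → f i ≡ g i) → any f (upTo n) ≡ any g (upTo n)
any-upTo-cong {f} {g} zero    f≗g = refl
any-upTo-cong {f} {g} (suc n) f≗g =
  trans (any-upTo-suc f n) (trans (cong₂ _∨_ (any-upTo-cong n (λ i i<n → f≗g i (m<n⇒m<1+n i<n))) (f≗g n ≤-refl)) (sym (any-upTo-suc g n)))

any-upTo-false : ∀ (f : ℕ → Bool) n → (∀ i → i < n → f i ≡ false) → any f (upTo n) ≡ false
any-upTo-false f zero    _    = refl
any-upTo-false f (suc n) none =
  trans (any-upTo-suc f n) (cong₂ _∨_ (any-upTo-false f n (λ i i<n → none i (m<n⇒m<1+n i<n))) (none n ≤-refl))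

any-upTo-true : ∀ (f : ℕ → Bool) n i → i < n → f i ≡ true → any f (upTo n) ≡ true
any-upTo-true f (suc n) i i<1+n fi with m≤n⇒m<n∨m≡n (s≤s⁻¹ i<1+n)
... | inj₁ i<n  = trans (any-upTo-suc f n) (cong (_∨ f n) (any-upTo-true f n i i<n fi))
... | inj₂ refl = trans (any-upTo-suc f i) (trans (cong (any f (upTo i) ∨_) fi) (∨-zeroʳ _))

module Occurrences (r u : ℕ) (2≤r : 2 ≤ r) where

  P : List ℕ
  P = vpattern r u

  occursAt : List ℕ → ℕ → ℕ → Bool
  occursAt w p q = (p + r ≤ᵇ q) ∧ orderIso? (take r (drop p w) ++ take 1 (drop q w)) P

  windowBefore : List ℕ → ℕ → ℕ → ℕ → Bool
  windowBefore h m z p = (p + r ≤ᵇ m) ∧ orderIso? (take r (drop p h) ++ (z ∷ [])) P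

  occursEndingWith : List ℕ → ℕ → Bool
  occursEndingWith h z = any (windowBefore h (length h) z) (upTo (length h))

  lastWindowMatches : List ℕ → ℕ → Bool
  lastWindowMatches h z = (r ≤ᵇ length h) ∧ orderIso? (takeLast r h ++ (z ∷ [])) P

  occurs-∷ʳ : ∀ h x → occurs r u (h ∷ʳ x) ≡ occurs r u h ∨ occursEndingWith h x
  occurs-∷ʳ h x = begin
      any (λ p → any (occursAt (h ∷ʳ x) p) (upTo (length (h ∷ʳ x)))) (upTo (length (h ∷ʳ x)))
    ≡⟨ cong (λ m → any (λ p → any (occursAt (h ∷ʳ x) p) (upTo m)) (upTo m)) (length-∷ʳ h x) ⟩
      any (λ p → any (occursAt (h ∷ʳ x) p) (upTo (suc n))) (upTo (suc n))
    ≡⟨ any-upTo-suc _ n ⟩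
      any (λ p → any (occursAt (h ∷ʳ x) p) (upTo (suc n))) (upTo n) ∨ any (occursAt (h ∷ʳ x) n) (upTo (suc n))
    ≡⟨ cong₂ _∨_ (any-upTo-cong n (λ p _ → trans (any-upTo-suc _ n) (cong₂ _∨_ (any-upTo-cong n (inside p)) (atEnd p))))
                 (any-upTo-false _ (suc n) tooLate) ⟩
      any (λ p → any (occursAt h p) (upTo n) ∨ windowBefore h n x p) (upTo n) ∨ false
    ≡⟨ ∨-identityʳ _ ⟩
      any (λ p → any (occursAt h p) (upTo n) ∨ windowBefore h n x p) (upTo n)
    ≡⟨ any-∨ _ _ (upTo n) ⟩
      occurs r u h ∨ occursEndingWith h x ∎
    where
      open ≡-Reasoning
      n : ℕ
      n = length h
      inside : ∀ p q → q < n → occursAt (h ∷ʳ x) p q ≡ occursAt h p q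
      inside p q q<n with p + r ≤ᵇ q in p+r≤q
      ... | false = refl
      ... | true rewrite take-drop-++ˡ p r h (x ∷ []) (≤-trans (≤ᵇ-true⁻¹ p+r≤q) (<⇒≤ q<n))
                       | take-drop-++ˡ q 1 h (x ∷ []) (subst (_≤ n) (+-comm 1 q) q<n) = refl
      atEnd : ∀ p → occursAt (h ∷ʳ x) p n ≡ windowBefore h n x p
      atEnd p with p + r ≤ᵇ n in p+r≤n
      ... | false = refl
      ... | true rewrite take-drop-++ˡ p r h (x ∷ []) (≤ᵇ-true⁻¹ p+r≤n) | drop-length-++ h (x ∷ []) = refl
      tooLate : ∀ q → q < suc n → occursAt (h ∷ʳ x) n q ≡ false
      tooLate q q≤n rewrite ≤ᵇ-false (<-≤-trans q≤n (subst (_≤ n + r) (+-comm n 1) (+-monoʳ-≤ n (≤-trans (s≤s z≤n) 2≤r)))) = refl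

  any-startsAt : ∀ n b → any (λ p → (p + r ≡ᵇ suc n) ∧ b) (upTo n) ≡ (r ≤ᵇ suc n) ∧ b
  any-startsAt n false = trans (any-upTo-false _ n (λ p _ → ∧-zeroʳ _)) (sym (∧-zeroʳ _))
  any-startsAt n true with r ≤? suc n
  ... | yes r≤1+n rewrite ≤ᵇ-true r≤1+n = any-upTo-true _ n (suc n ∸ r) start<n start+r
    where
      start<n : suc n ∸ r < n
      start<n = s≤s⁻¹ (subst (suc (suc (suc n ∸ r)) ≤_) (m∸n+n≡m r≤1+n)
                  (subst (_≤ (suc n ∸ r) + r) (+-comm (suc n ∸ r) 2) (+-monoʳ-≤ (suc n ∸ r) 2≤r)))
      start+r : (suc n ∸ r + r ≡ᵇ suc n) ∧ true ≡ true
      start+r rewrite m∸n+n≡m r≤1+n | ≡ᵇ-true (refl {x = n}) = refl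
  ... | no r≰1+n rewrite ≤ᵇ-false (≰⇒> r≰1+n) =
    any-upTo-false _ n (λ p _ → cong (_∧ true) (≡ᵇ-false (λ e → r≰1+n (subst (r ≤_) e (m≤n+m r p)))))

  windowBefore-∷ʳ : ∀ h y z p →
    windowBefore (h ∷ʳ y) (suc (length h)) z p
      ≡ windowBefore h (length h) z p ∨ ((p + r ≡ᵇ suc (length h)) ∧ orderIso? (takeLast r (h ∷ʳ y) ++ (z ∷ [])) P)
  windowBefore-∷ʳ h y z p with <-cmp (p + r) (suc (length h))
  ... | tri< p+r≤n _ _ rewrite ≤ᵇ-true (<⇒≤ p+r≤n) | ≤ᵇ-true (s≤s⁻¹ p+r≤n) | ≡ᵇ-false (<⇒≢ p+r≤n)
                             | take-drop-++ˡ p r h (y ∷ []) (s≤s⁻¹ p+r≤n) = sym (∨-identityʳ _)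
  ... | tri> _ _ p+r>1+n rewrite ≤ᵇ-false p+r>1+n | ≤ᵇ-false (<-trans (n<1+n _) p+r>1+n)
                               | ≡ᵇ-false (λ e → <⇒≢ p+r>1+n (sym e)) = refl
  ... | tri≈ _ p+r≡1+n _ rewrite ≤ᵇ-true (≤-reflexive p+r≡1+n) | ≤ᵇ-false (subst (length h <_) (sym p+r≡1+n) ≤-refl)
                               | ≡ᵇ-true p+r≡1+n = cong (λ w → orderIso? (w ++ (z ∷ [])) P) windowIsLast
    where
      h′ : List ℕ
      h′ = h ∷ʳ y
      p≡|h′|∸r : length h′ ∸ r ≡ p
      p≡|h′|∸r = trans (cong (_∸ r) (trans (length-∷ʳ h y) (sym p+r≡1+n))) (m+n∸n≡m p r)
      windowIsLast : take r (drop p h′) ≡ takeLast r h′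
      windowIsLast = trans (take-all r (drop p h′) (≤-reflexive (trans (length-drop p h′)
                             (trans (cong (_∸ p) (trans (length-∷ʳ h y) (sym p+r≡1+n))) (m+n∸m≡n p r)))))
                           (cong (λ q → drop q h′) (sym p≡|h′|∸r))

  occursEndingWith-∷ʳ : ∀ h y z → occursEndingWith (h ∷ʳ y) z ≡ occursEndingWith h z ∨ lastWindowMatches (h ∷ʳ y) z
  occursEndingWith-∷ʳ h y z = begin
      any (windowBefore (h ∷ʳ y) (length (h ∷ʳ y)) z) (upTo (length (h ∷ʳ y)))
    ≡⟨ cong (λ m → any (windowBefore (h ∷ʳ y) m z) (upTo m)) (length-∷ʳ h y) ⟩
      any (windowBefore (h ∷ʳ y) (suc n) z) (upTo (suc n))
    ≡⟨ any-upTo-suc _ n ⟩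
      any (windowBefore (h ∷ʳ y) (suc n) z) (upTo n) ∨ windowBefore (h ∷ʳ y) (suc n) z n
    ≡⟨ cong₂ _∨_ (any-upTo-cong n (λ p _ → windowBefore-∷ʳ h y z p)) tooShort ⟩
      any (λ p → windowBefore h n z p ∨ ((p + r ≡ᵇ suc n) ∧ lastMatch)) (upTo n) ∨ false
    ≡⟨ ∨-identityʳ _ ⟩
      any (λ p → windowBefore h n z p ∨ ((p + r ≡ᵇ suc n) ∧ lastMatch)) (upTo n)
    ≡⟨ any-∨ _ _ (upTo n) ⟩
      occursEndingWith h z ∨ any (λ p → (p + r ≡ᵇ suc n) ∧ lastMatch) (upTo n)
    ≡⟨ cong (occursEndingWith h z ∨_) (trans (any-startsAt n lastMatch) (cong (λ m → (r ≤ᵇ m) ∧ lastMatch) (sym (length-∷ʳ h y)))) ⟩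
      occursEndingWith h z ∨ lastWindowMatches (h ∷ʳ y) z ∎
    where
      open ≡-Reasoning
      n : ℕ
      n = length h
      lastMatch : Bool
      lastMatch = orderIso? (takeLast r (h ∷ʳ y) ++ (z ∷ [])) P
      tooShort : windowBefore (h ∷ʳ y) (suc n) z n ≡ false
      tooShort rewrite ≤ᵇ-false (subst (_≤ n + r) (+-comm n 2) (+-monoʳ-≤ n 2≤r)) = refl

-- The state of the scan is the set F of letters already forbidden and the final ascending run T
-- (at most its last r letters); a full run forbids the letters strictly between its a-th and (a+1)-th letters.
module Automaton (r a : ℕ) where

  gap : List ℕ → ℕ → Bool
  gap T z = (length T ≡ᵇ r) ∧ between (nth T a) (nth T (suc a)) z

  forbid : (ℕ → Bool) → List ℕ → ℕ → Bool
  forbid F T z = F z ∨ gap T z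

  ascends : List ℕ → ℕ → Bool
  ascends []       x = false
  ascends (t ∷ ts) x = lastOf (t ∷ ts) <ᵇ x

  push : List ℕ → ℕ → List ℕ
  push T x = if ascends T x then takeLast r (T ∷ʳ x) else x ∷ []

  accepts : (ℕ → Bool) → List ℕ → List ℕ → Bool
  accepts F T []      = true
  accepts F T (x ∷ w) = not (forbid F T x) ∧ accepts (forbid F T) (push T x) w

  ascends-nonempty : ∀ T x → 1 ≤ length T → ascends T x ≡ (lastOf T <ᵇ x)
  ascends-nonempty (t ∷ ts) x _ = refl

  overflow : List ℕ → ℕ
  overflow T = suc (length T) ∸ r

  overflow-full : ∀ {T} → length T ≡ r → overflow T ≡ 1
  overflow-full |T|≡r rewrite |T|≡r = m+n∸n≡m 1 r

  overflow-short : ∀ {T} → length T < r → overflow T ≡ 0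
  overflow-short = m≤n⇒m∸n≡0

  overflow<length : ∀ {T} → 2 ≤ r → 1 ≤ length T → length T ≤ r → overflow T < length T
  overflow<length {T} 2≤r 1≤T T≤r with length T ≟ r
  ... | yes |T|≡r = subst₂ _<_ (sym (overflow-full {T} |T|≡r)) (sym |T|≡r) 2≤r
  ... | no  |T|≢r = subst (_< length T) (sym (overflow-short {T} (≤∧≢⇒< T≤r |T|≢r))) 1≤T

  length-pushed≤r : ∀ {T} → 1 ≤ length T → length T ≤ r → suc (length T ∸ overflow T) ≤ r
  length-pushed≤r {T} 1≤T T≤r with length T ≟ r
  ... | yes |T|≡r rewrite overflow-full {T} |T|≡r = ≤-reflexive (trans (+-comm 1 (length T ∸ 1)) (trans (m∸n+n≡m 1≤T) |T|≡r))
  ... | no  |T|≢r rewrite overflow-short {T} (≤∧≢⇒< T≤r |T|≢r) = ≤∧≢⇒< T≤r |T|≢r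

  push-overflow : ∀ T x → overflow T ≤ length T → push T x ≡ (if ascends T x then drop (overflow T) T ∷ʳ x else x ∷ [])
  push-overflow T x o≤T = cong (if ascends T x then_else x ∷ [])
    (trans (cong (λ n → drop (n ∸ r) (T ∷ʳ x)) (length-∷ʳ T x)) (drop-++ˡ (overflow T) T (x ∷ []) o≤T))

  forbid-nothing : 0 < r → ∀ z → forbid (λ _ → false) [] z ≡ false
  forbid-nothing 0<r z rewrite ≡ᵇ-false (<⇒≢ 0<r) = refl

  acceptCount : (ℕ → Bool) → List ℕ → ℕ → ℕ → ℕ
  acceptCount F T n k = countWords (accepts F T) n k

  acceptCount-suc : ∀ F T n k → acceptCount F T (suc n) k
    ≡ sumBelow (λ x → if forbid F T x then 0 else acceptCount (forbid F T) (push T x) n k) k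
  acceptCount-suc F T n k = trans (countWords-suc (accepts F T) n k) (sumBelow-cong′ k step)
    where
      step : ∀ x → countWords (λ w → accepts F T (x ∷ w)) n k
                 ≡ (if forbid F T x then 0 else acceptCount (forbid F T) (push T x) n k)
      step x with forbid F T x
      ... | true  = countWords-false n k
      ... | false = refl

module Invariant (r a : ℕ) (a+2≤r : a + 2 ≤ r) where
  open Automaton r a
  open Pattern r a a+2≤r using (pattern-match; pattern-match⁻¹)

  2≤r : 2 ≤ r
  2≤r = ≤-trans (m≤n+m 2 a) a+2≤r

  open Occurrences r (suc (suc a)) 2≤r

  -- T is the final ascending run of the scanned word h, cut to its last r letters.
  record Run (h T : List ℕ) : Set where
    field
      suffix     : SuffixOf T h
      increasing : Increasing T
      bounded    : length T ≤ r
      started    : (h ≡ [] × T ≡ []) ⊎ (1 ≤ length T)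
      maximal    : length T < r → (length T ≡ length h) ⊎ (nth T 0 ≤ nth h (length h ∸ suc (length T)))

  gap-full : ∀ {h T} → Run h T → length T ≡ r → ∀ z → gap T z ≡ lastWindowMatches h z
  gap-full {h} {T} R |T|≡r z rewrite ≡ᵇ-true |T|≡r | ≤ᵇ-true (subst (_≤ length h) |T|≡r (suffix-length (Run.suffix R)))
                                   | trans (cong (λ l → drop (length h ∸ l) h) (sym |T|≡r)) (sym (Run.suffix R))
    with orderIso? (T ∷ʳ z) P in match
  ... | true = let (_ , lo<z , z<hi) = pattern-match⁻¹ T z |T|≡r match in between-inside lo<z z<hi
  ... | false with nth T a <? z | z <? nth T (suc a)
  ...   | yes lo<z | yes z<hi = contradiction (trans (sym match) (pattern-match T z |T|≡r (Run.increasing R) lo<z z<hi)) λ ()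
  ...   | no  lo≮z | _        = between-below {hi = nth T (suc a)} (≮⇒≥ lo≮z)
  ...   | yes _    | no  z≮hi = between-above {nth T a} (≮⇒≥ z≮hi)

  gap-short : ∀ {h T} → Run h T → length T ≢ r → ∀ z → gap T z ≡ lastWindowMatches h z
  gap-short {h} {T} R |T|≢r z rewrite ≡ᵇ-false |T|≢r with r ≤? length h
  ... | no  r≰h rewrite ≤ᵇ-false (≰⇒> r≰h) = refl
  ... | yes r≤h rewrite ≤ᵇ-true r≤h = sym noMatch
    where
      open Run R
      t : ℕ
      t = length T
      t<r : t < r
      t<r = ≤∧≢⇒< bounded |T|≢r
      t<h : t < length h
      t<h = <-≤-trans t<r r≤h
      1≤t : 1 ≤ t
      1≤t with started
      ... | inj₂ 1≤t       = 1≤t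
      ... | inj₁ (refl , _) = ⊥-elim (<⇒≱ (<-≤-trans (s≤s z≤n) 2≤r) r≤h)
      before : nth T 0 ≤ nth h (length h ∸ suc t)
      before with maximal t<r
      ... | inj₂ T₀≤ = T₀≤
      ... | inj₁ t≡h = ⊥-elim (<⇒≢ t<h t≡h)
      W : List ℕ
      W = takeLast r h
      |W|≡r : length W ≡ r
      |W|≡r = trans (length-drop (length h ∸ r) h) (m∸[m∸n]≡n r≤h)
      nth-W : ∀ s → s ≤ r → nth W (r ∸ s) ≡ nth h (length h ∸ s)
      nth-W s s≤r = trans (nth-drop (length h ∸ r) h (r ∸ s)) (cong (nth h) (∸+∸ (length h) r s s≤r r≤h))
      noMatch : orderIso? (W ∷ʳ z) P ≡ false
      noMatch with orderIso? (W ∷ʳ z) P in match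
      ... | false = refl
      ... | true  = ⊥-elim (<⇒≱ ascent before)
        where
          incW : Increasing W
          incW = proj₁ (pattern-match⁻¹ W z |W|≡r match)
          ascent : nth h (length h ∸ suc t) < nth T 0
          ascent = subst₂ _<_ (nth-W (suc t) t<r)
                              (trans (nth-W t (<⇒≤ t<r)) (sym (trans (nth-suffix suffix 0) (cong (nth h) (+-identityʳ _)))))
                              (incW (r ∸ suc t) (r ∸ t) (∸-monoʳ-< (n<1+n t) t<r) (subst (r ∸ t <_) (sym |W|≡r) (∸-monoʳ-< 1≤t (<⇒≤ t<r))))

  gap≡lastWindowMatches : ∀ {h T} → Run h T → ∀ z → gap T z ≡ lastWindowMatches h z
  gap≡lastWindowMatches {T = T} R with length T ≟ r
  ... | yes |T|≡r = gap-full R |T|≡r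
  ... | no  |T|≢r = gap-short R |T|≢r

  run-single : ∀ h x → (h ≡ []) ⊎ (1 ≤ length h × x ≤ lastOf h) → Run (h ∷ʳ x) (x ∷ [])
  run-single h x fresh = record
    { suffix     = trans (sym (drop-length-++ h (x ∷ []))) (cong (λ n → drop n (h ∷ʳ x)) (sym (cong pred (length-∷ʳ h x))))
    ; increasing = λ { i zero () _ ; i (suc j) _ (s≤s ()) }
    ; bounded    = ≤-trans (s≤s z≤n) 2≤r
    ; started    = inj₂ (s≤s z≤n)
    ; maximal    = λ _ → maximal fresh
    }
    where
      maximal : (h ≡ []) ⊎ (1 ≤ length h × x ≤ lastOf h) →
                (1 ≡ length (h ∷ʳ x)) ⊎ (x ≤ nth (h ∷ʳ x) (length (h ∷ʳ x) ∸ 2))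
      maximal (inj₁ refl)            = inj₁ refl
      maximal (inj₂ (1≤h , x≤last)) rewrite length-∷ʳ h x =
        inj₂ (subst (x ≤_) (sym (nth-++ˡ h (x ∷ []) (length h ∸ 1) (n∸1<n 1≤h))) x≤last)

  run-ascent : ∀ {h T} x → Run h T → 1 ≤ length T → lastOf T < x → Run (h ∷ʳ x) (drop (overflow T) T ∷ʳ x)
  run-ascent {h} {T} x R 1≤T last<x = record
    { suffix     = suffix-∷ʳ x (suffix-drop o (<⇒≤ o<T) suffix)
    ; increasing = Increasing-∷ʳ (drop o T) x (Increasing-drop o T increasing) (λ _ → subst (_< x) (sym (lastOf-drop o T o<T)) last<x)
    ; bounded    = subst (_≤ r) (sym length-new) (length-pushed≤r {T} 1≤T bounded)
    ; started    = inj₂ (subst (1 ≤_) (sym length-new) (s≤s z≤n))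
    ; maximal    = maximal′
    }
    where
      open Run R
      o : ℕ
      o = overflow T
      o<T : o < length T
      o<T = overflow<length {T} 2≤r 1≤T bounded
      length-new : length (drop o T ∷ʳ x) ≡ suc (length T ∸ o)
      length-new = trans (length-∷ʳ (drop o T) x) (cong suc (length-drop o T))
      maximal′ : length (drop o T ∷ʳ x) < r →
                 (length (drop o T ∷ʳ x) ≡ length (h ∷ʳ x)) ⊎ (nth (drop o T ∷ʳ x) 0 ≤ nth (h ∷ʳ x) (length (h ∷ʳ x) ∸ suc (length (drop o T ∷ʳ x))))
      maximal′ new<r with length T ≟ r
      ... | yes |T|≡r rewrite length-new | overflow-full {T} |T|≡r =
        ⊥-elim (<-irrefl (trans (+-comm 1 (length T ∸ 1)) (trans (m∸n+n≡m 1≤T) |T|≡r)) new<r)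
      ... | no |T|≢r rewrite overflow-short {T} (≤∧≢⇒< bounded |T|≢r) | length-∷ʳ T x | length-∷ʳ h x with maximal (≤∧≢⇒< bounded |T|≢r)
      ...   | inj₁ |T|≡|h| = inj₁ (cong suc |T|≡|h|)
      ...   | inj₂ T₀≤     = inj₂ (subst₂ _≤_ (sym (nth-++ˡ T (x ∷ []) 0 1≤T))
                                              (sym (nth-++ˡ h (x ∷ []) (length h ∸ suc (length T)) (≤-<-trans (∸-monoʳ-≤ (length h) (s≤s z≤n)) (n∸1<n (≤-trans 1≤T (suffix-length suffix)))))) T₀≤)

  run-push : ∀ {h T} x → Run h T → Run (h ∷ʳ x) (push T x)
  run-push {h} {T} x R with Run.started R
  ... | inj₁ (refl , refl) = run-single [] x (inj₁ refl)
  ... | inj₂ 1≤T rewrite push-overflow T x (<⇒≤ (overflow<length {T} 2≤r 1≤T (Run.bounded R))) | ascends-nonempty T x 1≤T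
    with lastOf T <ᵇ x in last<ᵇx
  ...   | true  = run-ascent x R 1≤T (<ᵇ-true⁻¹ last<ᵇx)
  ...   | false = run-single h x (inj₂ (≤-trans 1≤T (suffix-length (Run.suffix R)) ,
                                        subst (x ≤_) (lastOf-suffix (Run.suffix R) 1≤T) (<ᵇ-false⁻¹ last<ᵇx)))

  Invariant : List ℕ → (ℕ → Bool) → List ℕ → Set
  Invariant h F T = (∀ z → forbid F T z ≡ occursEndingWith h z) × Run h T

  invariant-∷ʳ : ∀ h F T x → Invariant h F T → Invariant (h ∷ʳ x) (forbid F T) (push T x)
  invariant-∷ʳ h F T x (forbids , R) =
    (λ z → trans (cong₂ _∨_ (forbids z) (gap≡lastWindowMatches (run-push x R) z)) (sym (occursEndingWith-∷ʳ h x z))) , run-push x R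

  not-∨-∧ : ∀ a b c → not (a ∨ b) ∧ c ≡ not a ∧ (not b ∧ c)
  not-∨-∧ true  b     c = refl
  not-∨-∧ false true  c = refl
  not-∨-∧ false false c = refl

  avoids-++ : ∀ w h F T → Invariant h F T → not (occurs r (suc (suc a)) (h ++ w)) ≡ not (occurs r (suc (suc a)) h) ∧ accepts F T w
  avoids-++ []      h F T _   rewrite ++-identityʳ h = sym (∧-identityʳ _)
  avoids-++ (x ∷ w) h F T inv = begin
      not (occurs r u (h ++ x ∷ w))
    ≡⟨ cong (λ l → not (occurs r u l)) (sym (++-assoc h (x ∷ []) w)) ⟩
      not (occurs r u ((h ∷ʳ x) ++ w))
    ≡⟨ avoids-++ w (h ∷ʳ x) (forbid F T) (push T x) (invariant-∷ʳ h F T x inv) ⟩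
      not (occurs r u (h ∷ʳ x)) ∧ accepts (forbid F T) (push T x) w
    ≡⟨ cong (λ b → not b ∧ accepts (forbid F T) (push T x) w) (trans (occurs-∷ʳ h x) (cong (occurs r u h ∨_) (sym (proj₁ inv x)))) ⟩
      not (occurs r u h ∨ forbid F T x) ∧ accepts (forbid F T) (push T x) w
    ≡⟨ not-∨-∧ (occurs r u h) (forbid F T x) _ ⟩
      not (occurs r u h) ∧ accepts F T (x ∷ w) ∎
    where
      open ≡-Reasoning
      u : ℕ
      u = suc (suc a)

  avoids≡accepts : ∀ w → not (occurs r (suc (suc a)) w) ≡ accepts (λ _ → false) [] w
  avoids≡accepts w = avoids-++ w [] (λ _ → false) [] (forbid-nothing (≤-trans (s≤s z≤n) 2≤r) , emptyRun)
    where
      emptyRun : Run [] []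
      emptyRun = record
        { suffix     = refl
        ; increasing = λ { i j _ () }
        ; bounded    = z≤n
        ; started    = inj₁ (refl , refl)
        ; maximal    = λ _ → inj₁ refl
        }

excess : List ℕ → ℕ
excess D = sum (map (_∸ 1) D)

excess-take-suc : ∀ m Y → m < length Y → excess (take (suc m) Y) ≡ excess (take m Y) + (nth Y m ∸ 1)
excess-take-suc zero    (y ∷ Y) _       = +-comm (y ∸ 1) 0
excess-take-suc (suc m) (y ∷ Y) (s≤s p) = trans (cong ((y ∸ 1) +_) (excess-take-suc m Y p)) (sym (+-assoc (y ∸ 1) _ _))

module CompressedCount (r : ℕ) where

  -- The letters forbidden by the windows of an ascending run with rank gaps D once one more letter
  -- is read: each window forbids its gap at position a, minus one.
  killed : ℕ → List ℕ → ℕ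
  killed a D = excess (take (length D + 2 ∸ r) (drop a D))

  -- Continuations of length n of a scan summarised by (U, c, D) (see Compression.Summarises):
  -- the next letter either starts a new run at rank j or ascends by d + 1 ranks.
  compressedCount : ℕ → ℕ → ℕ → List ℕ → ℕ → ℕ
  compressedCount a U c D zero    = 1
  compressedCount a U c D (suc n) =
      sumBelow (λ j → compressedCount a (U + (c ∸ killed a D) ∸ j) j [] n) (suc (c ∸ killed a D))
    + sumBelow (λ d → compressedCount a (U ∸ suc d) (c + suc d) (D ∷ʳ suc d) n) U

  restarts : ℕ → ℕ → ℕ → ℕ → ℕ
  restarts a U c m = sumBelow (λ j → compressedCount a (U + c ∸ j) j [] m) (suc c)

  -- The continuations that ascend N times by the gaps X and then restart, or end if N = n.
  afterAscents : ℕ → ℕ → ℕ → List ℕ → ℕ → ℕ → List ℕ → ℕ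
  afterAscents a U c D n N X =
    if N ≡ᵇ n then 1 else restarts a (U ∸ sum X) ((c + sum X) ∸ killed a (D ++ X)) (n ∸ suc N)

  compressedCount-byAscents : ∀ a n U c D →
    compressedCount a U c D n ≡ sumBelow (λ N → tupleSum N U (afterAscents a U c D n N)) (suc n)
  compressedCount-byAscents a zero    U c D = refl
  compressedCount-byAscents a (suc n) U c D = begin
      restarts a U (c ∸ killed a D) n + sumBelow (λ d → compressedCount a (U ∸ suc d) (c + suc d) (D ∷ʳ suc d) n) U
    ≡⟨ cong₂ _+_ noAscent (sumBelow-cong′ U (λ d → compressedCount-byAscents a n (U ∸ suc d) (c + suc d) (D ∷ʳ suc d))) ⟩
      A 0 + sumBelow (λ d → sumBelow (λ N → tupleSum N (U ∸ suc d) (afterAscents a (U ∸ suc d) (c + suc d) (D ∷ʳ suc d) n N)) (suc n)) U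
    ≡⟨ cong (A 0 +_) (sumBelow-comm _ U (suc n)) ⟩
      A 0 + sumBelow (λ N → sumBelow (λ d → tupleSum N (U ∸ suc d) (afterAscents a (U ∸ suc d) (c + suc d) (D ∷ʳ suc d) n N)) U) (suc n)
    ≡⟨ cong (A 0 +_) (sumBelow-cong′ (suc n) (λ N → sumBelow-cong′ U (λ d → tupleSum-cong N (U ∸ suc d) (λ X _ → sym (firstAscent N d X))))) ⟩
      A 0 + sumBelow (λ N → A (suc N)) (suc n)
    ≡⟨ sumBelow-sucˡ A (suc n) ⟨
      sumBelow A (suc (suc n)) ∎
    where
      open ≡-Reasoning
      A : ℕ → ℕ
      A N = tupleSum N U (afterAscents a U c D (suc n) N)
      noAscent : restarts a U (c ∸ killed a D) n ≡ A 0
      noAscent rewrite +-identityʳ c | ++-identityʳ D = refl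
      firstAscent : ∀ N d X → afterAscents a U c D (suc n) (suc N) (suc d ∷ X)
                              ≡ afterAscents a (U ∸ suc d) (c + suc d) (D ∷ʳ suc d) n N X
      firstAscent N d X rewrite ∸-+-assoc U (suc d) (sum X) | +-assoc c (suc d) (sum X) | ++-assoc D (suc d ∷ []) X = refl

  killed-moveRight : ∀ a X → a + 3 ≤ r → killed a (moveRight a (length X + 2 ∸ r) X) ≡ killed (suc a) X
  killed-moveRight a X a+3≤r rewrite moveRight-length (length X + 2 ∸ r) a X with r ≤? length X + 2
  ... | no r≰ rewrite m≤n⇒m∸n≡0 (≤-trans (n≤1+n _) (≰⇒> r≰)) = refl
  ... | yes r≤ = cong excess (take-drop-moveRight (length X + 2 ∸ r) a X
                   (+-∸-≤ (suc a) 2 r (length X) (subst (_≤ r) (+-suc a 2) a+3≤r) r≤))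

  compressedCount-shift : ∀ a → a + 3 ≤ r → ∀ n U c →
    compressedCount a U c [] n ≡ compressedCount (suc a) U c [] n
  compressedCount-shift a a+3≤r = <-rec _ step
    where
      step : ∀ n → (∀ {m} → m < n → ∀ U c → compressedCount a U c [] m ≡ compressedCount (suc a) U c [] m) →
             ∀ U c → compressedCount a U c [] n ≡ compressedCount (suc a) U c [] n
      step n ih U c = begin
          compressedCount a U c [] n
        ≡⟨ compressedCount-byAscents a n U c [] ⟩
          sumBelow (λ N → tupleSum N U (afterAscents a U c [] n N)) (suc n)
        ≡⟨ sumBelow-cong (suc n) (λ N N≤n → trans (tupleSum-moveRight (N + 2 ∸ r) a N U _)
                                               (tupleSum-cong N U (λ { X refl → ascents X N≤n }))) ⟩
          sumBelow (λ N → tupleSum N U (afterAscents (suc a) U c [] n N)) (suc n)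
        ≡⟨ compressedCount-byAscents (suc a) n U c [] ⟨
          compressedCount (suc a) U c [] n ∎
        where
          open ≡-Reasoning
          ascents : ∀ X → length X < suc n →
            afterAscents a U c [] n (length X) (moveRight a (length X + 2 ∸ r) X) ≡ afterAscents (suc a) U c [] n (length X) X
          ascents X N<1+n with length X ≡ᵇ n in N≢n
          ... | true  = refl
          ... | false rewrite moveRight-sum (length X + 2 ∸ r) a X | killed-moveRight a X a+3≤r =
            sumBelow-cong′ (suc _) (λ j → ih (∸-suc-< (≤∧≢⇒< (s≤s⁻¹ N<1+n) λ e → subst T N≢n (≡⇒≡ᵇ _ _ e))) _ j)

  compressedCount-≤-indep : ∀ a b → a ≤ b → b + 2 ≤ r → ∀ n U c →
    compressedCount a U c [] n ≡ compressedCount b U c [] n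
  compressedCount-≤-indep a zero    z≤n _ n U c = refl
  compressedCount-≤-indep a (suc b) a≤b b+2≤r n U c with m≤n⇒m<n∨m≡n a≤b
  ... | inj₂ refl = refl
  ... | inj₁ a<b  = trans (compressedCount-≤-indep a b (s≤s⁻¹ a<b) (≤-trans (n≤1+n _) b+2≤r) n U c)
                          (compressedCount-shift b (subst (_≤ r) (sym (+-suc b 2)) b+2≤r) n U c)

  compressedCount-indep : ∀ a b → a + 2 ≤ r → b + 2 ≤ r → ∀ n U c →
    compressedCount a U c [] n ≡ compressedCount b U c [] n
  compressedCount-indep a b a+2≤r b+2≤r n U c with ≤-total a b
  ... | inj₁ a≤b = compressedCount-≤-indep a b a≤b b+2≤r n U c
  ... | inj₂ b≤a = sym (compressedCount-≤-indep b a b≤a a+2≤r n U c)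

module Compression (r a k : ℕ) (a+2≤r : a + 2 ≤ r) where
  open CompressedCount r
  open Automaton r a

  killedBefore : List ℕ → ℕ
  killedBefore D = excess (take (suc (length D) ∸ r) (drop a D))

  killedBefore-∷ʳ : ∀ D d → killedBefore (D ∷ʳ d) ≡ killed a D
  killedBefore-∷ʳ D d rewrite length-∷ʳ D d | sym (+-comm (length D) 2) with r ≤? length D + 2
  ... | no r≰ rewrite m≤n⇒m∸n≡0 (≤-trans (n≤1+n _) (≰⇒> r≰)) = refl
  ... | yes r≤ = cong excess (take-drop-++ˡ a (length D + 2 ∸ r) D (d ∷ []) (+-∸-≤ a 2 r (length D) a+2≤r r≤))

  killedBefore-[] : killedBefore [] ≡ 0
  killedBefore-[] rewrite drop-[] {A = ℕ} a | take-[] {A = ℕ} (1 ∸ r) = refl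

  -- (U, c, D) summarises the scan state (F, T) for counting: U usable letters lie above the last
  -- letter of the run, c below it once the letters forbidden by the run's own windows are counted
  -- back in, and D ends with the rank gaps along the run from position a on.
  record Summarises (F : ℕ → Bool) (T : List ℕ) (U c : ℕ) (D : List ℕ) : Set where
    field
      nonempty   : 1 ≤ length T
      bounded-r  : length T ≤ r
      bounded-D  : length T ≤ suc (length D)
      full⊎whole : (length T ≡ r) ⊎ (length T ≡ suc (length D))
      alive      : ∀ i → i < length T → F (nth T i) ≡ false
      letters<k  : ∀ i → i < length T → nth T i < k
      increasing : Increasing T
      rankLast   : rank F (lastOf T) + killedBefore D ≡ c
      rankAbove  : U + suc (rank F (lastOf T)) ≡ rank F k
      rankGaps   : ∀ i → a ≤ i → suc i < length T →
                   rank F (nth T (suc i)) ∸ rank F (nth T i) ≡ nth D (suc (length D) ∸ length T + i)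

  summarises-single : ∀ F x → F x ≡ false → x < k → ∀ {U} → U + suc (rank F x) ≡ rank F k →
                      Summarises F (x ∷ []) U (rank F x) []
  summarises-single F x Fx x<k rankAbove = record
    { nonempty   = s≤s z≤n
    ; bounded-r  = ≤-trans (s≤s z≤n) (subst (_≤ r) (+-comm a 2) a+2≤r)
    ; bounded-D  = ≤-refl
    ; full⊎whole = inj₂ refl
    ; alive      = λ { zero _ → Fx ; (suc i) (s≤s ()) }
    ; letters<k  = λ { zero _ → x<k ; (suc i) (s≤s ()) }
    ; increasing = λ { i zero () _ ; i (suc j) _ (s≤s ()) }
    ; rankLast   = trans (cong (rank F x +_) killedBefore-[]) (+-identityʳ (rank F x))
    ; rankAbove  = rankAbove
    ; rankGaps   = λ { i _ (s≤s ()) }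
    }

  module NextLetter {F T U c D} (R : Summarises F T U c D) where
    open Summarises R

    L lo hi : ℕ
    L  = length T
    lo = nth T a
    hi = nth T (suc a)

    F′ : ℕ → Bool
    F′ = forbid F T

    -- The number of usable letters forbidden by the window that the run completes.
    Δ : ℕ
    Δ = if L ≡ᵇ r then rank F hi ∸ suc (rank F lo) else 0

    c′ : ℕ
    c′ = c ∸ killed a D

    1+a<L : L ≡ r → suc a < L
    1+a<L L≡r = subst (suc a <_) (sym L≡r) (subst (_≤ r) (+-comm a 2) a+2≤r)

    a<L : L ≡ r → a < L
    a<L L≡r = <-trans (n<1+n a) (1+a<L L≡r)

    lastIdx : ℕ
    lastIdx = L ∸ 1

    lastIdx<L : lastIdx < L
    lastIdx<L = n∸1<n nonempty

    forbid-full : L ≡ r → ∀ z → F′ z ≡ withGap F lo hi z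
    forbid-full L≡r z rewrite ≡ᵇ-true L≡r = refl

    forbid-short : L ≢ r → ∀ z → F′ z ≡ F z
    forbid-short L≢r z rewrite ≡ᵇ-false L≢r = ∨-identityʳ (F z)

    Δ-full : L ≡ r → Δ ≡ rank F hi ∸ suc (rank F lo)
    Δ-full L≡r rewrite ≡ᵇ-true L≡r = refl

    Δ-short : L ≢ r → Δ ≡ 0
    Δ-short L≢r rewrite ≡ᵇ-false L≢r = refl

    gap-run : ∀ i → i < L → gap T (nth T i) ≡ false
    gap-run i i<L with L ≟ r
    ... | no L≢r rewrite ≡ᵇ-false L≢r = refl
    ... | yes L≡r rewrite ≡ᵇ-true L≡r with i ≤? a
    ...   | yes i≤a = between-below {hi = hi} (Increasing-≤ {T} increasing i a i≤a (a<L L≡r))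
    ...   | no i≰a  = between-above {lo} (Increasing-≤ {T} increasing (suc a) i (≰⇒> i≰a) i<L)

    alive′ : ∀ i → i < L → F′ (nth T i) ≡ false
    alive′ i i<L rewrite alive i i<L = gap-run i i<L

    o : ℕ
    o = overflow T

    rank-aboveGap : ∀ x → (L ≡ r → hi ≤ x) → rank F x ≡ rank F′ x + Δ
    rank-aboveGap x hi≤x with L ≟ r
    ... | yes L≡r = begin
        rank F x
      ≡⟨ rank-withGap-above F lo hi x (increasing a (suc a) (n<1+n a) (1+a<L L≡r)) (alive a (a<L L≡r)) (hi≤x L≡r) ⟩
        rank (withGap F lo hi) x + (rank F hi ∸ suc (rank F lo))
      ≡⟨ cong₂ _+_ (rank-cong _ _ x (λ z _ → sym (forbid-full L≡r z))) (sym (Δ-full L≡r)) ⟩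
        rank F′ x + Δ ∎
      where open ≡-Reasoning
    ... | no L≢r = begin
        rank F x
      ≡⟨ rank-cong F′ F x (λ z _ → forbid-short L≢r z) ⟨
        rank F′ x
      ≡⟨ +-identityʳ _ ⟨
        rank F′ x + 0
      ≡⟨ cong (rank F′ x +_) (Δ-short L≢r) ⟨
        rank F′ x + Δ ∎
      where open ≡-Reasoning

    rank-aboveGap-run : ∀ i → o + a ≤ i → i < L → rank F (nth T i) ≡ rank F′ (nth T i) + Δ
    rank-aboveGap-run i o+a≤i i<L = rank-aboveGap (nth T i) λ L≡r →
      Increasing-≤ {T} increasing (suc a) i (subst (λ o → o + a ≤ i) (overflow-full {T} L≡r) o+a≤i) i<L

    rank-aboveGap-last : rank F (lastOf T) ≡ rank F′ (lastOf T) + Δ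
    rank-aboveGap-last = rank-aboveGap (lastOf T) λ L≡r →
      Increasing-≤ {T} increasing (suc a) lastIdx (m+n≤o⇒m≤o∸n (suc a) (subst (_≤ L) (+-comm 1 (suc a)) (1+a<L L≡r))) lastIdx<L

    rank-aboveGap-k : rank F k ≡ rank F′ k + Δ
    rank-aboveGap-k = rank-aboveGap k λ L≡r → <⇒≤ (letters<k (suc a) (1+a<L L≡r))

    killed-short : L ≢ r → killed a D ≡ killedBefore D + Δ
    killed-short L≢r = begin
        excess (take (length D + 2 ∸ r) (drop a D))
      ≡⟨ cong (λ m → excess (take m (drop a D))) (m≤n⇒m∸n≡0 (subst (_≤ r) (+-comm 2 (length D)) 2+D≤r)) ⟩
        0
      ≡⟨ cong₂ _+_ (cong (λ m → excess (take m (drop a D))) (m≤n⇒m∸n≡0 (≤-trans (n≤1+n _) 2+D≤r))) (Δ-short L≢r) ⟨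
        killedBefore D + Δ ∎
      where
        open ≡-Reasoning
        L≡1+D : L ≡ suc (length D)
        L≡1+D = [ (λ L≡r → ⊥-elim (L≢r L≡r)) , (λ e → e) ]′ full⊎whole
        2+D≤r : suc (suc (length D)) ≤ r
        2+D≤r = subst (_< r) L≡1+D (≤∧≢⇒< bounded-r L≢r)

    killed-full : L ≡ r → killed a D ≡ killedBefore D + Δ
    killed-full L≡r = begin
        excess (take (length D + 2 ∸ r) (drop a D))
      ≡⟨ cong (λ z → excess (take z (drop a D))) D+2∸r ⟩
        excess (take (suc m) (drop a D))
      ≡⟨ excess-take-suc m (drop a D) m<|a↓D| ⟩
        killedBefore D + (nth (drop a D) m ∸ 1)
      ≡⟨ cong (λ i → killedBefore D + (i ∸ 1)) (trans (nth-drop a D m) (cong (nth D) (+-comm a m))) ⟩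
        killedBefore D + (nth D (m + a) ∸ 1)
      ≡⟨ cong (λ l → killedBefore D + (nth D (suc (length D) ∸ l + a) ∸ 1)) L≡r ⟨
        killedBefore D + (nth D (suc (length D) ∸ L + a) ∸ 1)
      ≡⟨ cong (λ i → killedBefore D + (i ∸ 1)) (rankGaps a ≤-refl (1+a<L L≡r)) ⟨
        killedBefore D + (rank F hi ∸ rank F lo ∸ 1)
      ≡⟨ cong (killedBefore D +_) (trans (∸-+-assoc (rank F hi) (rank F lo) 1) (cong (rank F hi ∸_) (+-comm (rank F lo) 1))) ⟩
        killedBefore D + (rank F hi ∸ suc (rank F lo))
      ≡⟨ cong (killedBefore D +_) (Δ-full L≡r) ⟨
        killedBefore D + Δ ∎
      where
        open ≡-Reasoning
        r≤1+D : r ≤ suc (length D)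
        r≤1+D = subst (_≤ suc (length D)) L≡r bounded-D
        m : ℕ
        m = suc (length D) ∸ r
        D+2∸r : length D + 2 ∸ r ≡ suc m
        D+2∸r = trans (cong (_∸ r) (+-suc (length D) 1)) (trans (+-∸-comm 1 r≤1+D) (+-comm m 1))
        m<|a↓D| : m < length (drop a D)
        m<|a↓D| = subst (m <_) (sym (length-drop a D))
          (m+n≤o⇒m≤o∸n (suc m) (subst (_≤ length D) (cong suc (+-comm a m))
            (subst (λ l → suc a + (l ∸ r) ≤ length D) (+-comm (length D) 1)
              (+-∸-≤ (suc a) 1 r (length D) (subst (_≤ r) (+-suc a 1) a+2≤r) (subst (r ≤_) (+-comm 1 (length D)) r≤1+D)))))

    killed-split : killed a D ≡ killedBefore D + Δ
    killed-split with L ≟ r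
    ... | yes L≡r = killed-full L≡r
    ... | no L≢r  = killed-short L≢r

    rankLast+killed : rank F′ (lastOf T) + killed a D ≡ c
    rankLast+killed = begin
        rank F′ (lastOf T) + killed a D
      ≡⟨ cong (rank F′ (lastOf T) +_) (trans killed-split (+-comm (killedBefore D) Δ)) ⟩
        rank F′ (lastOf T) + (Δ + killedBefore D)
      ≡⟨ +-assoc (rank F′ (lastOf T)) Δ (killedBefore D) ⟨
        rank F′ (lastOf T) + Δ + killedBefore D
      ≡⟨ cong (_+ killedBefore D) rank-aboveGap-last ⟨
        rank F (lastOf T) + killedBefore D
      ≡⟨ rankLast ⟩
        c ∎
      where open ≡-Reasoning

    rank′-last : rank F′ (lastOf T) ≡ c′
    rank′-last = trans (sym (m+n∸n≡m (rank F′ (lastOf T)) (killed a D))) (cong (_∸ killed a D) rankLast+killed)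

    rank′-k : rank F′ k ≡ U + suc c′
    rank′-k = trans (+-cancelʳ-≡ Δ _ _ (begin
        rank F′ k + Δ
      ≡⟨ rank-aboveGap-k ⟨
        rank F k
      ≡⟨ rankAbove ⟨
        U + suc (rank F (lastOf T))
      ≡⟨ cong (λ z → U + suc z) rank-aboveGap-last ⟩
        U + suc (rank F′ (lastOf T) + Δ)
      ≡⟨ +-assoc U (suc (rank F′ (lastOf T))) Δ ⟨
        U + suc (rank F′ (lastOf T)) + Δ ∎)) (cong (λ z → U + suc z) rank′-last)
      where open ≡-Reasoning

    summarises-restart : ∀ x → F′ x ≡ false → x < k → rank F′ x ≤ c′ →
                         Summarises F′ (x ∷ []) (U + c′ ∸ rank F′ x) (rank F′ x) []
    summarises-restart x F′x x<k j≤c′ = summarises-single F′ x F′x x<k (begin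
        U + c′ ∸ rank F′ x + suc (rank F′ x)
      ≡⟨ +-suc _ (rank F′ x) ⟩
        suc (U + c′ ∸ rank F′ x + rank F′ x)
      ≡⟨ cong suc (m∸n+n≡m (≤-trans j≤c′ (m≤n+m c′ U))) ⟩
        suc (U + c′)
      ≡⟨ +-suc U c′ ⟨
        U + suc c′
      ≡⟨ rank′-k ⟨
        rank F′ k ∎)
      where open ≡-Reasoning

    o<L : o < L
    o<L = overflow<length {T} (≤-trans (m≤n+m 2 a) a+2≤r) nonempty bounded-r

    module Ascent (x : ℕ) (F′x : F′ x ≡ false) (x<k : x < k) (c′<j : c′ < rank F′ x) where
      j d M : ℕ
      j = rank F′ x
      d = j ∸ c′
      M = L ∸ o

      run : List ℕ
      run = drop o T ∷ʳ x

      last<x : lastOf T < x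
      last<x = <ᵇ-true⁻¹ (trans (rank-<ᵇ F′ (lastOf T) x (alive′ lastIdx lastIdx<L) F′x)
                                (trans (cong (_<ᵇ j) rank′-last) (<ᵇ-true c′<j)))

      j≡c′+d : j ≡ c′ + d
      j≡c′+d = sym (m+[n∸m]≡n (<⇒≤ c′<j))

      d≤U : d ≤ U
      d≤U = +-cancelˡ-≤ c′ d U (begin
          c′ + d  ≡⟨ j≡c′+d ⟨
          j       ≤⟨ s≤s⁻¹ (subst (j <_) (trans rank′-k (+-suc U c′)) (rank-< F′ F′x x<k)) ⟩
          U + c′  ≡⟨ +-comm U c′ ⟩
          c′ + U  ∎)
        where open ≤-Reasoning

      length-run : length run ≡ suc M
      length-run = trans (length-∷ʳ (drop o T) x) (cong suc (length-drop o T))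

      nth-run : ∀ i → i < M → nth run i ≡ nth T (o + i)
      nth-run i i<M = trans (nth-++ˡ (drop o T) (x ∷ []) i (subst (i <_) (sym (length-drop o T)) i<M)) (nth-drop o T i)

      nth-run-last : nth run M ≡ x
      nth-run-last = trans (cong (nth run) (sym (length-drop o T))) (nth-∷ʳ-last (drop o T) x)

      o+i<L : ∀ i → i < M → o + i < L
      o+i<L i i<M = <∸⇒+< i<M

      lastOf-run : lastOf run ≡ x
      lastOf-run = lastOf-∷ʳ (drop o T) x

      index<D : ∀ i → suc i < M → suc (length D) ∸ L + (o + i) < length D
      index<D i 1+i<M = s≤s⁻¹ (begin
          suc (suc (suc (length D) ∸ L + (o + i)))
        ≡⟨ trans (+-suc _ (suc (o + i))) (cong suc (+-suc _ (o + i))) ⟨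
          suc (length D) ∸ L + suc (suc (o + i))
        ≤⟨ +-monoʳ-≤ (suc (length D) ∸ L) (subst (_≤ L) (cong suc (+-suc o i)) (o+i<L (suc i) 1+i<M)) ⟩
          suc (length D) ∸ L + L
        ≡⟨ m∸n+n≡m bounded-D ⟩
          suc (length D) ∎)
        where open ≤-Reasoning

      gap-inner : ∀ i → a ≤ i → suc i < M →
                  rank F′ (nth run (suc i)) ∸ rank F′ (nth run i) ≡ nth (D ∷ʳ d) (suc (length D) ∸ M + i)
      gap-inner i a≤i 1+i<M = begin
          rank F′ (nth run (suc i)) ∸ rank F′ (nth run i)
        ≡⟨ cong₂ (λ p q → rank F′ p ∸ rank F′ q) (nth-run (suc i) 1+i<M) (nth-run i (<-trans (n<1+n i) 1+i<M)) ⟩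
          rank F′ (nth T (o + suc i)) ∸ rank F′ (nth T (o + i))
        ≡⟨ [m+n]∸[m+o]≡n∸o Δ _ _ ⟨
          Δ + rank F′ (nth T (o + suc i)) ∸ (Δ + rank F′ (nth T (o + i)))
        ≡⟨ cong₂ _∸_ (trans (+-comm Δ _) (sym (rank-aboveGap-run (o + suc i) (+-monoʳ-≤ o (≤-trans a≤i (n≤1+n i))) (o+i<L (suc i) 1+i<M))))
                     (trans (+-comm Δ _) (sym (rank-aboveGap-run (o + i) (+-monoʳ-≤ o a≤i) (o+i<L i (<-trans (n<1+n i) 1+i<M))))) ⟩
          rank F (nth T (o + suc i)) ∸ rank F (nth T (o + i))
        ≡⟨ cong (λ p → rank F (nth T p) ∸ rank F (nth T (o + i))) (+-suc o i) ⟩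
          rank F (nth T (suc (o + i))) ∸ rank F (nth T (o + i))
        ≡⟨ rankGaps (o + i) (≤-trans a≤i (m≤n+m i o)) (subst (_< L) (+-suc o i) (o+i<L (suc i) 1+i<M)) ⟩
          nth D (suc (length D) ∸ L + (o + i))
        ≡⟨ nth-++ˡ D (d ∷ []) _ (index<D i 1+i<M) ⟨
          nth (D ∷ʳ d) (suc (length D) ∸ L + (o + i))
        ≡⟨ cong (nth (D ∷ʳ d)) (trans (sym (+-assoc (suc (length D) ∸ L) o i)) (cong (_+ i) (∸-+-∸ (suc (length D)) L o (<⇒≤ o<L) bounded-D))) ⟩
          nth (D ∷ʳ d) (suc (length D) ∸ M + i) ∎
        where
          open ≡-Reasoning

      gap-last : ∀ i → suc i ≡ M →
                 rank F′ (nth run (suc i)) ∸ rank F′ (nth run i) ≡ nth (D ∷ʳ d) (suc (length D) ∸ M + i)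
      gap-last i 1+i≡M = begin
          rank F′ (nth run (suc i)) ∸ rank F′ (nth run i)
        ≡⟨ cong₂ (λ p q → rank F′ p ∸ rank F′ q) (trans (cong (nth run) 1+i≡M) nth-run-last)
                                                 (trans (nth-run i (subst (i <_) 1+i≡M (n<1+n i))) (cong (nth T) o+i≡lastIdx)) ⟩
          j ∸ rank F′ (lastOf T)
        ≡⟨ cong (j ∸_) rank′-last ⟩
          d
        ≡⟨ nth-∷ʳ-last D d ⟨
          nth (D ∷ʳ d) (length D)
        ≡⟨ cong (nth (D ∷ʳ d)) (trans (cong (λ m → suc (length D) ∸ m + i) (sym 1+i≡M)) (m∸n+n≡m i≤D)) ⟨
          nth (D ∷ʳ d) (suc (length D) ∸ M + i) ∎
        where
          open ≡-Reasoning
          o+i≡lastIdx : o + i ≡ lastIdx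
          o+i≡lastIdx = cong pred (trans (sym (+-suc o i)) (trans (cong (o +_) 1+i≡M) (m+[n∸m]≡n (<⇒≤ o<L))))
          i≤D : i ≤ length D
          i≤D = s≤s⁻¹ (≤-trans (≤-reflexive 1+i≡M) (≤-trans (m∸n≤m L o) bounded-D))

      1+M≡r⊎ : (suc M ≡ r) ⊎ (suc M ≡ suc (suc (length D)))
      1+M≡r⊎ with L ≟ r | full⊎whole
      ... | yes L≡r | _         rewrite overflow-full {T} L≡r = inj₁ (trans (+-comm 1 (L ∸ 1)) (trans (m∸n+n≡m nonempty) L≡r))
      ... | no  L≢r | inj₁ L≡r  = ⊥-elim (L≢r L≡r)
      ... | no  L≢r | inj₂ L≡1+D rewrite overflow-short {T} (≤∧≢⇒< bounded-r L≢r) = inj₂ (cong suc L≡1+D)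

      rankLast′ : rank F′ (lastOf run) + killedBefore (D ∷ʳ d) ≡ c + d
      rankLast′ rewrite lastOf-run | killedBefore-∷ʳ D d = begin
          j + killed a D                         ≡⟨ cong (_+ killed a D) (trans j≡c′+d (+-comm c′ d)) ⟩
          d + c′ + killed a D                    ≡⟨ +-assoc d c′ (killed a D) ⟩
          d + (c′ + killed a D)                  ≡⟨ cong (λ z → d + (z + killed a D)) rank′-last ⟨
          d + (rank F′ (lastOf T) + killed a D)  ≡⟨ cong (d +_) rankLast+killed ⟩
          d + c                                  ≡⟨ +-comm d c ⟩
          c + d                                  ∎
        where open ≡-Reasoning

      rankAbove′ : U ∸ d + suc (rank F′ (lastOf run)) ≡ rank F′ k
      rankAbove′ rewrite lastOf-run = begin
          U ∸ d + suc j          ≡⟨ +-suc (U ∸ d) j ⟩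
          suc (U ∸ d + j)        ≡⟨ cong (λ z → suc (U ∸ d + z)) (trans j≡c′+d (+-comm c′ d)) ⟩
          suc (U ∸ d + (d + c′)) ≡⟨ cong suc (+-assoc (U ∸ d) d c′) ⟨
          suc (U ∸ d + d + c′)   ≡⟨ cong (λ z → suc (z + c′)) (m∸n+n≡m d≤U) ⟩
          suc (U + c′)           ≡⟨ +-suc U c′ ⟨
          U + suc c′             ≡⟨ rank′-k ⟨
          rank F′ k              ∎
        where open ≡-Reasoning

      rankGaps′ : ∀ i → a ≤ i → suc i < length run →
        rank F′ (nth run (suc i)) ∸ rank F′ (nth run i) ≡ nth (D ∷ʳ d) (suc (length (D ∷ʳ d)) ∸ length run + i)
      rankGaps′ i a≤i 1+i<run rewrite length-run | length-∷ʳ D d with m≤n⇒m<n∨m≡n (s≤s⁻¹ 1+i<run)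
      ... | inj₁ 1+i<M = gap-inner i a≤i 1+i<M
      ... | inj₂ 1+i≡M = gap-last i 1+i≡M

      summarises-ascent : Summarises F′ run (U ∸ d) (c + d) (D ∷ʳ d)
      summarises-ascent = record
        { nonempty   = subst (1 ≤_) (sym length-run) (s≤s z≤n)
        ; bounded-r  = subst (_≤ r) (sym length-run) (length-pushed≤r {T} nonempty bounded-r)
        ; bounded-D  = subst₂ _≤_ (sym length-run) (cong suc (sym (length-∷ʳ D d))) (s≤s (≤-trans (m∸n≤m L o) bounded-D))
        ; full⊎whole = subst (λ l → (l ≡ r) ⊎ (l ≡ suc (length (D ∷ʳ d)))) (sym length-run)
                         (subst (λ l → (suc M ≡ r) ⊎ (suc M ≡ suc l)) (sym (length-∷ʳ D d)) 1+M≡r⊎)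
        ; alive      = nth-∷ʳ-∀ (λ z → F′ z ≡ false) (drop o T) x (nth-drop-∀ (λ z → F′ z ≡ false) o T alive′) F′x
        ; letters<k  = nth-∷ʳ-∀ (_< k) (drop o T) x (nth-drop-∀ (_< k) o T letters<k) x<k
        ; increasing = Increasing-∷ʳ (drop o T) x (Increasing-drop o T increasing)
                         (λ _ → subst (_< x) (sym (lastOf-drop o T o<L)) last<x)
        ; rankLast   = rankLast′
        ; rankAbove  = rankAbove′
        ; rankGaps   = rankGaps′
        }

  acceptCount-compressed : ∀ n {F T U c D} → Summarises F T U c D → acceptCount F T n k ≡ compressedCount a U c D n
  acceptCount-compressed zero    R = refl
  acceptCount-compressed (suc n) {F} {T} {U} {c} {D} R = begin
      acceptCount F T (suc n) k
    ≡⟨ acceptCount-suc F T n k ⟩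
      sumBelow (λ x → if F′ x then 0 else acceptCount F′ (push T x) n k) k
    ≡⟨ sumBelow-cong k byRank ⟩
      sumBelow (λ x → if F′ x then 0 else next (rank F′ x)) k
    ≡⟨ sumBelow-byRank F′ next k ⟩
      sumBelow next (rank F′ k)
    ≡⟨ cong (sumBelow next) (trans rank′-k (+-comm U (suc c′))) ⟩
      sumBelow next (suc c′ + U)
    ≡⟨ sumBelow-+ next (suc c′) U ⟩
      sumBelow next (suc c′) + sumBelow (λ d → next (suc c′ + d)) U
    ≡⟨ cong₂ _+_ (sumBelow-cong (suc c′) restart) (sumBelow-cong′ U ascent) ⟩
      compressedCount a U c D (suc n) ∎
    where
      open ≡-Reasoning
      open NextLetter R
      open Summarises R using (nonempty)
      next : ℕ → ℕ
      next j = if c′ <ᵇ j then compressedCount a (U ∸ (j ∸ c′)) (c + (j ∸ c′)) (D ∷ʳ (j ∸ c′)) n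
                          else compressedCount a (U + c′ ∸ j) j [] n
      restart : ∀ j → j < suc c′ → next j ≡ compressedCount a (U + c′ ∸ j) j [] n
      restart j j≤c′ rewrite <ᵇ-false (s≤s⁻¹ j≤c′) = refl
      ascent : ∀ d → next (suc c′ + d) ≡ compressedCount a (U ∸ suc d) (c + suc d) (D ∷ʳ suc d) n
      ascent d rewrite <ᵇ-true (s≤s (m≤m+n c′ d)) | sym (+-suc c′ d) | m+n∸m≡n c′ (suc d) = refl
      byRank : ∀ x → x < k → (if F′ x then 0 else acceptCount F′ (push T x) n k) ≡ (if F′ x then 0 else next (rank F′ x))
      byRank x x<k with F′ x in F′x
      ... | true  = refl
      ... | false rewrite push-overflow T x (<⇒≤ o<L) | ascends-nonempty T x nonempty
                        | rank-<ᵇ F′ (lastOf T) x (alive′ lastIdx lastIdx<L) F′x | rank′-last with c′ <ᵇ rank F′ x in c′<ᵇj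
      ...   | true  = acceptCount-compressed n (Ascent.summarises-ascent x F′x x<k (<ᵇ-true⁻¹ c′<ᵇj))
      ...   | false = acceptCount-compressed n (summarises-restart x F′x x<k (<ᵇ-false⁻¹ c′<ᵇj))

  acceptCount-start : ∀ n → acceptCount (λ _ → false) [] (suc n) k ≡ sumBelow (λ x → compressedCount a (k ∸ suc x) x [] n) k
  acceptCount-start n = trans (acceptCount-suc (λ _ → false) [] n k) (sumBelow-cong k first)
    where
      F₁ : ℕ → Bool
      F₁ = forbid (λ _ → false) []
      nothing-forbidden : ∀ z → F₁ z ≡ false
      nothing-forbidden = forbid-nothing (≤-trans (s≤s z≤n) (≤-trans (m≤n+m 2 a) a+2≤r))
      rank-F₁ : ∀ y → rank F₁ y ≡ y
      rank-F₁ zero    = refl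
      rank-F₁ (suc y) = trans (rank-suc F₁ {y} (nothing-forbidden y)) (cong suc (rank-F₁ y))
      first : ∀ x → x < k → (if F₁ x then 0 else acceptCount F₁ (push [] x) n k) ≡ compressedCount a (k ∸ suc x) x [] n
      first x x<k rewrite nothing-forbidden x =
        subst (λ c → acceptCount F₁ (x ∷ []) n k ≡ compressedCount a (k ∸ suc x) c [] n) (rank-F₁ x)
              (acceptCount-compressed n (summarises-single F₁ x (nothing-forbidden x) x<k above))
        where
          above : k ∸ suc x + suc (rank F₁ x) ≡ rank F₁ k
          above rewrite rank-F₁ x | rank-F₁ k = m∸n+n≡m x<k

avoidFormula : ℕ → ℕ → ℕ → ℕ → ℕ
avoidFormula r a k zero    = 1
avoidFormula r a k (suc n) = sumBelow (λ x → CompressedCount.compressedCount r a (k ∸ suc x) x [] n) k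

avoidCount-formula : ∀ r a k → a + 2 ≤ r → ∀ n → avoidCount r (suc (suc a)) n k ≡ avoidFormula r a k n
avoidCount-formula r a k a+2≤r n = trans (countWords-cong n k (Invariant.avoids≡accepts r a a+2≤r)) (accepted n)
  where
    accepted : ∀ n → Automaton.acceptCount r a (λ _ → false) [] n k ≡ avoidFormula r a k n
    accepted zero    = refl
    accepted (suc n) = Compression.acceptCount-start r a k a+2≤r n

avoidFormula-indep : ∀ r a b k → a + 2 ≤ r → b + 2 ≤ r → ∀ n → avoidFormula r a k n ≡ avoidFormula r b k n
avoidFormula-indep r a b k a+2≤r b+2≤r zero    = refl
avoidFormula-indep r a b k a+2≤r b+2≤r (suc n) =
  sumBelow-cong′ k (λ x → CompressedCount.compressedCount-indep r a b a+2≤r b+2≤r n (k ∸ suc x) x)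

theorem2p4 : (r u v : ℕ) → 3 ≤ r → 2 ≤ u → u ≤ r → 2 ≤ v → v ≤ r → WilfEquiv r u v
theorem2p4 r (suc (suc a)) (suc (suc b)) _ (s≤s (s≤s _)) u≤r (s≤s (s≤s _)) v≤r n k _ = begin
    avoidCount r (suc (suc a)) n k  ≡⟨ avoidCount-formula r a k a+2≤r n ⟩
    avoidFormula r a k n            ≡⟨ avoidFormula-indep r a b k a+2≤r b+2≤r n ⟩
    avoidFormula r b k n            ≡⟨ avoidCount-formula r b k b+2≤r n ⟨
    avoidCount r (suc (suc b)) n k  ∎
  where
    open ≡-Reasoning
    a+2≤r : a + 2 ≤ r
    a+2≤r = subst (_≤ r) (+-comm 2 a) u≤r
    b+2≤r : b + 2 ≤ r
    b+2≤r = subst (_≤ r) (+-comm 2 b) v≤r
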